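{- Let $k\ge 0$, $r\ge0$ and $0\le i\le r$ be integers. The number of $k$-multi-labeled Dyck paths in $\mathcal T_k(r,i)$ equals $$T_k(r,i)=(r+1)^{i-1}\binom{k(r+1)+r-1-i}{r-i}.$$
   Context: $\mathcal T_k(r,i)$ is the set of lattice paths from $(0,0)$ to $(r,r)$ using north steps $(0,1)$ and east steps $(1,0)$ that stay weakly above the line $y=x$, together with a labeling of the $r$ north steps such that each label in $\{1,2,\ldots,i\}$ is used exactly once, the remaining $r-i$ north steps receive labels from $\{\overline{k-1},\ldots,\overline{1},\overline{0}\}$ (repetitions allowed), and the labels are weakly increasing along each maximal run of consecutive north steps, with respect to the total order $\overline{k-1}<\cdots<\overline{1}<\overline{0}<1<2<\cdots<i$. Note $(r+1)^{i-1}\binom{k(r+1)+r-1-i}{r-i}=(r+1)^{i-1}\left(\!\binom{k(r+1)}{r-i}\!\right)$, the multiset coefficient. -}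

module Defs where

open import Data.Nat using (ℕ; zero; suc; _+_; _*_; _∸_; _^_; _≡ᵇ_; _≤ᵇ_)
open import Data.Nat.DivMod using (_/_)
open import Data.Nat.Combinatorics using (_C_)
open import Data.Fin using (Fin; toℕ)
open import Data.Fin.Properties using (_≟_)
open import Data.Bool using (Bool; true; false; _∧_; if_then_else_)
open import Data.List using (List; []; _∷_; allFin)
open import Data.Product using (Σ)
open import Relation.Nullary.Decidable using (does)
open import Relation.Binary.PropositionalEquality using (_≡_)

-- Labels of north steps: bar j stands for \overline{j} (j = 0..k-1),
-- lab j stands for the label (toℕ j + 1) ∈ {1,…,i}.
data Label (k i : ℕ) : Set where
  bar : Fin k → Label k i
  lab : Fin i → Label k i

_≤L_ : ∀ {k i} → Label k i → Label k i → Bool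
bar a ≤L bar b = toℕ b ≤ᵇ toℕ a
bar _ ≤L lab _ = true
lab _ ≤L bar _ = false
lab a ≤L lab b = toℕ a ≤ᵇ toℕ b

data Step (k i : ℕ) : Set where
  N : Label k i → Step k i
  E : Step k i

numN : ∀ {k i} → List (Step k i) → ℕ
numN []          = 0
numN (N _ ∷ w)   = suc (numN w)
numN (E ∷ w)     = numN w

numE : ∀ {k i} → List (Step k i) → ℕ
numE []          = 0
numE (N _ ∷ w)   = numE w
numE (E ∷ w)     = suc (numE w)

staysAbove : ∀ {k i} → ℕ → List (Step k i) → Bool
staysAbove h []             = true
staysAbove h (N _ ∷ w)      = staysAbove (suc h) w
staysAbove zero (E ∷ w)     = false
staysAbove (suc h) (E ∷ w)  = staysAbove h w

occ : ∀ {k i} → Fin i → List (Step k i) → ℕ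
occ j []            = 0
occ j (E ∷ w)       = occ j w
occ j (N (bar _) ∷ w) = occ j w
occ j (N (lab a) ∷ w) = if does (a ≟ j) then suc (occ j w) else occ j w

allB : {A : Set} → (A → Bool) → List A → Bool
allB p []       = true
allB p (x ∷ xs) = p x ∧ allB p xs

labelsOnce : ∀ {k i} → List (Step k i) → Bool
labelsOnce {k} {i} w = allB (λ j → occ j w ≡ᵇ 1) (allFin i)

runsIncreasing : ∀ {k i} → List (Step k i) → Bool
runsIncreasing []                   = true
runsIncreasing (E ∷ w)              = runsIncreasing w
runsIncreasing (N a ∷ [])           = true
runsIncreasing (N a ∷ E ∷ w)        = runsIncreasing w
runsIncreasing (N a ∷ N b ∷ w)      = (a ≤L b) ∧ runsIncreasing (N b ∷ w)

isTk : (k r i : ℕ) → List (Step k i) → Bool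
isTk k r i w =
  (numN w ≡ᵇ r) ∧ (numE w ≡ᵇ r) ∧ staysAbove 0 w ∧ labelsOnce w ∧ runsIncreasing w

𝒯 : (k r i : ℕ) → Set
𝒯 k r i = Σ (List (Step k i)) (λ w → isTk k r i w ≡ true)

-- multiset coefficient ((n multichoose m)) = C(n+m-1, m), with ((0,0)) = 1
multichoose : ℕ → ℕ → ℕ
multichoose zero zero       = 1
multichoose zero (suc m)    = 0
multichoose (suc n) m       = (n + m) C m

-- T_k(r,i) = (r+1)^{i-1} ((k(r+1) multichoose r-i)), written as an exact
-- natural-number division so that the case i = 0 is covered.
Tformula : (k r i : ℕ) → ℕ
Tformula k r i = ((suc r) ^ i * multichoose (k * suc r) (r ∸ i)) / suc r

-- Cutting a path of 𝒯_k(r,i) at its r east steps leaves r + 1 maximal runs of north steps.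
-- Labels increase weakly along a run, so a run is just the multiset of its labels, and the
-- path becomes a list of r + 1 multiplicity vectors in which each of 1, …, i occurs once,
-- barred labels occur r - i times in total, and the run lengths satisfy the Dyck condition.
-- Without the Dyck condition such lists are easy to count: every unbarred label picks its
-- run, in (r+1)^i ways, and the barred labels form a multiset of size r - i over the
-- k(r+1) pairs (run, bar), in ((k(r+1) multichoose r - i)) ways. The run lengths sum to
-- r, one less than their number, so by the cycle lemma exactly one of the r + 1 cyclic
-- rotations of such a list satisfies the Dyck condition; dividing by r + 1 gives T_k(r,i).

module Submission where

open import Defs
open import Data.Fin using (Fin)
open import Data.List using (List)
open import Data.Nat using (ℕ; suc; _*_; _^_; _∸_; _≤_)
open import Data.Product using (Σ; _×_)
open import Data.Product.Function.NonDependent.Propositional using (_×-↔_)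
open import Function.Bundles using (_↔_)
open import Function.Properties.Inverse using (↔-refl)

module Cardinalities where

  open import Axiom.UniquenessOfIdentityProofs using (module Decidable⇒UIP)
  open import Data.Bool using (Bool; true)
  open import Data.Bool.Properties using () renaming (_≟_ to _≟ᴮ_)
  open import Data.Fin using (Fin; zero; suc)
  open import Data.Fin.Permutation using (↔⇒≡)
  open import Data.Fin.Properties using (+↔⊎; *↔×; 0↔⊥; 1↔⊤) renaming (_≟_ to _≟ᶠ_)
  open import Data.Nat using (ℕ; zero; suc; _+_; _*_)
  open import Data.Nat.Combinatorics using (_C_; k>n⇒nCk≡0; nCk+nC[k+1]≡[n+1]C[k+1])
  open import Data.Nat.DivMod using (_/_; m*n/n≡m)
  open import Data.Nat.Properties using (+-comm; +-suc; ≤-refl; m+n≡0⇒m≡0; m+n≡0⇒n≡0; suc-injective)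
  import Data.Nat.Properties as ℕ
  open import Data.Product using (Σ; _×_; _,_; proj₁; proj₂)
  open import Data.Product.Function.Dependent.Propositional using (Σ-↔)
  open import Data.Product.Function.NonDependent.Propositional using (_×-↔_)
  open import Data.Sum using (_⊎_; inj₁; inj₂)
  open import Data.Sum.Function.Propositional using (_⊎-↔_)
  open import Data.Unit using (tt)
  open import Data.Vec using (Vec; []; _∷_; sum)
  open import Function using (_∘_)
  open import Function.Bundles using (_↔_; Inverse; mk↔ₛ′)
  open import Function.Properties.Inverse using (↔-refl; ↔-sym; ↔-trans)
  open import Function.Related.Propositional using (module EquationalReasoning; bijection)
  open import Relation.Binary.PropositionalEquality using (_≡_; refl; sym; trans; cong; cong₂; subst; module ≡-Reasoning)
  open import Relation.Nullary using (Dec; yes; no; Irrelevant)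

  open import Defs using (multichoose)

  module ↔-Reasoning = EquationalReasoning {k = bijection}

  ≡true-irrelevant : {b : Bool} → Irrelevant (b ≡ true)
  ≡true-irrelevant = Decidable⇒UIP.≡-irrelevant _≟ᴮ_

  ×-irrelevant : {P Q : Set} → Irrelevant P → Irrelevant Q → Irrelevant (P × Q)
  ×-irrelevant P-irr Q-irr (p , q) (p′ , q′) = cong₂ _,_ (P-irr p p′) (Q-irr q q′)

  irrelevant-↔ : {P Q : Set} → Irrelevant P → Irrelevant Q → (P → Q) → (Q → P) → P ↔ Q
  irrelevant-↔ P-irr Q-irr f g = mk↔ₛ′ f g (λ _ → Q-irr _ _) (λ _ → P-irr _ _)

  Σ-↔-irrelevant : {A B : Set} {P : A → Set} {Q : B → Set} (e : A ↔ B) →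
                   (∀ {x} → Irrelevant (P x)) → (∀ {y} → Irrelevant (Q y)) →
                   (∀ x → P x → Q (Inverse.to e x)) → (∀ y → Q y → P (Inverse.from e y)) →
                   Σ A P ↔ Σ B Q
  Σ-↔-irrelevant {P = P} e P-irr Q-irr f g = Σ-↔ e (irrelevant-↔ P-irr Q-irr (f _)
    (λ q → subst P (Inverse.strictlyInverseʳ e _) (g _ q)))

  Dec-count : {P : Set} → Dec P → ℕ
  Dec-count (yes _) = 1
  Dec-count (no _)  = 0

  irrelevant-Dec↔Fin : {P : Set} → Irrelevant P → (P? : Dec P) → P ↔ Fin (Dec-count P?)
  irrelevant-Dec↔Fin P-irr (yes p) = ↔-trans (irrelevant-↔ P-irr (λ _ _ → refl) (λ _ → tt) (λ _ → p)) (↔-sym 1↔⊤)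
  irrelevant-Dec↔Fin P-irr (no ¬p) = ↔-trans (irrelevant-↔ P-irr (λ ()) ¬p λ ()) (↔-sym 0↔⊥)

  Σ-≡-irrelevant : {A : Set} {P : A → Set} → (∀ {x} → Irrelevant (P x)) →
                   {x y : A} {p : P x} {q : P y} → x ≡ y → (x , p) ≡ (y , q)
  Σ-≡-irrelevant irr refl = cong (_ ,_) (irr _ _)

  Σ-Fin-suc↔ : ∀ {n} {P : Fin (suc n) → Set} → Σ (Fin (suc n)) P ↔ (P zero ⊎ Σ (Fin n) (P ∘ suc))
  Σ-Fin-suc↔ {P = P} = mk↔ₛ′ to from to∘from from∘to
    where
    to : Σ _ P → P zero ⊎ Σ _ (P ∘ suc)
    to (zero  , p) = inj₁ p
    to (suc x , p) = inj₂ (x , p)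
    from : P zero ⊎ Σ _ (P ∘ suc) → Σ _ P
    from (inj₁ p)       = zero , p
    from (inj₂ (x , p)) = suc x , p
    to∘from : ∀ y → to (from y) ≡ y
    to∘from (inj₁ p)       = refl
    to∘from (inj₂ (x , p)) = refl
    from∘to : ∀ x → from (to x) ≡ x
    from∘to (zero  , p) = refl
    from∘to (suc x , p) = refl

  count : ∀ {n} {P : Fin n → Set} → (∀ x → Dec (P x)) → ℕ
  count {zero}  P? = 0
  count {suc n} P? = Dec-count (P? zero) + count (P? ∘ suc)

  Σ-Fin↔Fin-count : ∀ {n} {P : Fin n → Set} → (∀ {x} → Irrelevant (P x)) →
                    (P? : ∀ x → Dec (P x)) → Σ (Fin n) P ↔ Fin (count P?)
  Σ-Fin↔Fin-count {zero}  _     _  = mk↔ₛ′ (λ ()) (λ ()) (λ ()) (λ ())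
  Σ-Fin↔Fin-count {suc n} {P} P-irr P? = begin
    Σ (Fin (suc n)) P                        ↔⟨ Σ-Fin-suc↔ ⟩
    (P zero ⊎ Σ (Fin n) (P ∘ suc))           ↔⟨ irrelevant-Dec↔Fin P-irr (P? zero) ⊎-↔ Σ-Fin↔Fin-count P-irr (P? ∘ suc) ⟩
    (Fin (Dec-count (P? zero)) ⊎ Fin (count (P? ∘ suc))) ↔⟨ ↔-sym +↔⊎ ⟩
    Fin (count P?)                           ∎
    where open ↔-Reasoning

  ↔-cancel-×Fin : ∀ {A : Set} {m n} → (A × Fin (suc n)) ↔ Fin m → A ↔ Fin (m / suc n)
  ↔-cancel-×Fin {A} {m} {n} e = subst (λ c → A ↔ Fin c) c≡m/n A↔Fin-c
    where
    open Inverse e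
    InFibre : Fin m → Set
    InFibre x = proj₂ (from x) ≡ zero
    InFibre? : ∀ x → Dec (InFibre x)
    InFibre? x = proj₂ (from x) ≟ᶠ zero
    InFibre-irrelevant : ∀ {x} → Irrelevant (InFibre x)
    InFibre-irrelevant = Decidable⇒UIP.≡-irrelevant _≟ᶠ_
    A↔fibre : A ↔ Σ (Fin m) InFibre
    A↔fibre = mk↔ₛ′ (λ a → to (a , zero) , cong proj₂ (strictlyInverseʳ (a , zero)))
                    (λ (x , _) → proj₁ (from x))
                    (λ (x , p) → Σ-≡-irrelevant InFibre-irrelevant
                       (trans (cong (λ z → to (proj₁ (from x) , z)) (sym p)) (strictlyInverseˡ x)))
                    (λ a → cong proj₁ (strictlyInverseʳ (a , zero)))
    c : ℕ
    c = count InFibre?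
    A↔Fin-c : A ↔ Fin c
    A↔Fin-c = ↔-trans A↔fibre (Σ-Fin↔Fin-count InFibre-irrelevant InFibre?)
    c*n≡m : c * suc n ≡ m
    c*n≡m = ↔⇒≡ (begin
      Fin (c * suc n)       ↔⟨ *↔× ⟩
      (Fin c × Fin (suc n)) ↔⟨ ↔-sym A↔Fin-c ×-↔ ↔-refl ⟩
      (A × Fin (suc n))     ↔⟨ e ⟩
      Fin m                 ∎)
      where open ↔-Reasoning
    c≡m/n : c ≡ m / suc n
    c≡m/n = trans (sym (m*n/n≡m c (suc n))) (cong (_/ suc n) c*n≡m)

  Composition : ℕ → ℕ → Set
  Composition n m = Σ (Vec ℕ n) (λ v → sum v ≡ m)

  multichoose-zero : ∀ n → multichoose n 0 ≡ 1
  multichoose-zero zero    = refl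
  multichoose-zero (suc n) = refl

  multichoose-suc : ∀ n m → multichoose n (suc m) + multichoose (suc n) m ≡ multichoose (suc n) (suc m)
  multichoose-suc zero m = begin
    0 + m C m                ≡⟨ cong (_+ m C m) (sym (k>n⇒nCk≡0 {m} {suc m} ≤-refl)) ⟩
    m C suc m + m C m        ≡⟨ +-comm (m C suc m) (m C m) ⟩
    m C m + m C suc m        ≡⟨ nCk+nC[k+1]≡[n+1]C[k+1] m m ⟩
    suc m C suc m            ∎
    where open ≡-Reasoning
  multichoose-suc (suc n) m = begin
    (n + suc m) C suc m + (suc n + m) C m   ≡⟨ cong (λ x → x C suc m + (suc n + m) C m) (+-suc n m) ⟩
    (suc n + m) C suc m + (suc n + m) C m   ≡⟨ +-comm ((suc n + m) C suc m) _ ⟩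
    (suc n + m) C m + (suc n + m) C suc m   ≡⟨ nCk+nC[k+1]≡[n+1]C[k+1] (suc n + m) m ⟩
    suc (suc n + m) C suc m                 ≡⟨ cong (_C suc m) (sym (+-suc (suc n) m)) ⟩
    (suc n + suc m) C suc m                 ∎
    where open ≡-Reasoning

  Composition-suc-zero↔ : ∀ n → Composition (suc n) 0 ↔ Composition n 0
  Composition-suc-zero↔ n = mk↔ₛ′
    (λ { (c ∷ v , e) → v , m+n≡0⇒n≡0 c e })
    (λ (v , e) → 0 ∷ v , e)
    (λ _ → Σ-≡-irrelevant ℕ.≡-irrelevant refl)
    (λ { (c ∷ v , e) → Σ-≡-irrelevant ℕ.≡-irrelevant (cong (_∷ v) (sym (m+n≡0⇒m≡0 c e))) })

  Composition-suc-suc↔ : ∀ n m → Composition (suc n) (suc m) ↔ (Composition n (suc m) ⊎ Composition (suc n) m)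
  Composition-suc-suc↔ n m = mk↔ₛ′ to from to∘from from∘to
    where
    to : Composition (suc n) (suc m) → Composition n (suc m) ⊎ Composition (suc n) m
    to (zero  ∷ v , e) = inj₁ (v , e)
    to (suc c ∷ v , e) = inj₂ (c ∷ v , suc-injective e)
    from : Composition n (suc m) ⊎ Composition (suc n) m → Composition (suc n) (suc m)
    from (inj₁ (v , e))     = zero ∷ v , e
    from (inj₂ (c ∷ v , e)) = suc c ∷ v , cong suc e
    to∘from : ∀ y → to (from y) ≡ y
    to∘from (inj₁ _)       = refl
    to∘from (inj₂ (_ ∷ _ , _)) = cong inj₂ (Σ-≡-irrelevant ℕ.≡-irrelevant refl)
    from∘to : ∀ x → from (to x) ≡ x
    from∘to (zero  ∷ _ , _) = refl
    from∘to (suc _ ∷ _ , _) = Σ-≡-irrelevant ℕ.≡-irrelevant refl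

  Composition↔Fin : ∀ n m → Composition n m ↔ Fin (multichoose n m)
  Composition↔Fin zero zero = mk↔ₛ′ (λ _ → zero) (λ _ → [] , refl) (λ { zero → refl }) (λ { ([] , refl) → refl })
  Composition↔Fin zero (suc m) = mk↔ₛ′ (λ { ([] , ()) }) (λ ()) (λ ()) (λ { ([] , ()) })
  Composition↔Fin (suc n) zero = begin
    Composition (suc n) 0  ↔⟨ Composition-suc-zero↔ n ⟩
    Composition n 0        ↔⟨ Composition↔Fin n 0 ⟩
    Fin (multichoose n 0)  ≡⟨ cong Fin (multichoose-zero n) ⟩
    Fin 1                  ∎
    where open ↔-Reasoning
  Composition↔Fin (suc n) (suc m) = begin
    Composition (suc n) (suc m)                             ↔⟨ Composition-suc-suc↔ n m ⟩
    (Composition n (suc m) ⊎ Composition (suc n) m)         ↔⟨ Composition↔Fin n (suc m) ⊎-↔ Composition↔Fin (suc n) m ⟩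
    (Fin (multichoose n (suc m)) ⊎ Fin (multichoose (suc n) m)) ↔⟨ ↔-sym +↔⊎ ⟩
    Fin (multichoose n (suc m) + multichoose (suc n) m)     ≡⟨ cong Fin (multichoose-suc n m) ⟩
    Fin (multichoose (suc n) (suc m))                       ∎
    where open ↔-Reasoning

module Matrices where

  open import Axiom.UniquenessOfIdentityProofs using (module Decidable⇒UIP)
  open import Data.Fin using (Fin; zero; suc)
  open import Data.Fin.Properties using (*↔×)
  open import Data.List using (List; []; _∷_; length)
  import Data.List as List
  open import Data.List.Relation.Binary.Permutation.Propositional using (_↭_)
  import Data.List.Relation.Binary.Permutation.Propositional.Properties as ↭
  open import Data.Nat using (ℕ; zero; suc; _+_; _*_; _^_)
  open import Data.Nat.Combinatorics using (nC1≡n)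
  open import Data.Nat.ListAction using () renaming (sum to sumˡ)
  open import Data.Nat.ListAction.Properties using (sum-↭)
  open import Data.Nat.Properties using (suc-injective; +-comm)
  import Data.Nat.Properties as ℕ
  open import Data.Nat.Tactic.RingSolver using (solve-∀)
  open import Data.Product using (Σ; _×_; _,_; proj₁; proj₂)
  open import Data.Product.Function.NonDependent.Propositional using (_×-↔_)
  open import Data.Vec using (Vec; []; _∷_; _++_; sum; map; lookup; zipWith; replicate; toList; concat; group; take; drop; head; tail)
  open import Data.Vec.Properties using (length-toList; ≡-dec; ∷-injective; tabulate∘lookup; tabulate-cong; lookup-zipWith; lookup-replicate; sum-++; take++drop≡id; ++-injective)
  open import Function using (_∘_)
  open import Function.Bundles using (_↔_; mk↔ₛ′)
  open import Function.Properties.Inverse using (↔-sym; ↔-trans)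
  open import Function.Related.TypeIsomorphisms using (Σ-assoc)
  open import Relation.Binary.PropositionalEquality using (_≡_; refl; sym; trans; cong; cong₂; subst; module ≡-Reasoning)
  open import Relation.Nullary using (Irrelevant)

  open import Defs using (multichoose)
  open Cardinalities

  private variable
    A : Set
    m n : ℕ

  lookup-extensionality : {u v : Vec A n} → (∀ j → lookup u j ≡ lookup v j) → u ≡ v
  lookup-extensionality {u = u} {v} u≗v = trans (sym (tabulate∘lookup u)) (trans (tabulate-cong u≗v) (tabulate∘lookup v))

  fromList-length : ∀ n (xs : List A) → length xs ≡ n → Vec A n
  fromList-length zero    []       _   = []
  fromList-length (suc n) (x ∷ xs) eq = x ∷ fromList-length n xs (suc-injective eq)

  toList-fromList-length : ∀ n (xs : List A) (eq : length xs ≡ n) → toList (fromList-length n xs eq) ≡ xs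
  toList-fromList-length zero    []       _  = refl
  toList-fromList-length (suc n) (x ∷ xs) eq = cong (x ∷_) (toList-fromList-length n xs (suc-injective eq))

  fromList-length-toList : ∀ n (v : Vec A n) (eq : length (toList v) ≡ n) → fromList-length n (toList v) eq ≡ v
  fromList-length-toList zero    []       _  = refl
  fromList-length-toList (suc n) (x ∷ v) eq = cong (x ∷_) (fromList-length-toList n v (suc-injective eq))

  List-length↔Vec : ∀ n → Σ (List A) (λ xs → length xs ≡ n) ↔ Vec A n
  List-length↔Vec n = mk↔ₛ′ (λ (xs , eq) → fromList-length n xs eq) (λ v → toList v , length-toList v)
    (λ v → fromList-length-toList n v (length-toList v))
    (λ (xs , eq) → Σ-≡-irrelevant ℕ.≡-irrelevant (toList-fromList-length n xs eq))

  Σ-List-length↔Σ-Vec : ∀ n {Q : List A → Set} → (∀ {xs} → Irrelevant (Q xs)) →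
                        Σ (List A) (λ xs → length xs ≡ n × Q xs) ↔ Σ (Vec A n) (Q ∘ toList)
  Σ-List-length↔Σ-Vec n {Q} Q-irr = ↔-trans (↔-sym Σ-assoc)
    (Σ-↔-irrelevant (List-length↔Vec n) Q-irr Q-irr
      (λ (xs , eq) q → subst Q (sym (toList-fromList-length n xs eq)) q) (λ _ q → q))

  concat-injective : ∀ {k} (xss yss : Vec (Vec A k) n) → concat xss ≡ concat yss → xss ≡ yss
  concat-injective []         []         _  = refl
  concat-injective (xs ∷ xss) (ys ∷ yss) eq with ++-injective xs ys eq
  ... | xs≡ys , concat≡ = cong₂ _∷_ xs≡ys (concat-injective xss yss concat≡)

  concat-↔ : ∀ n k → Vec (Vec A k) n ↔ Vec A (n * k)
  concat-↔ n k = mk↔ₛ′ concat (proj₁ ∘ group n k) (sym ∘ proj₂ ∘ group n k)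
    (λ xss → concat-injective _ xss (sym (proj₂ (group n k (concat xss)))))

  sum-concat : ∀ {k} (xss : Vec (Vec ℕ k) n) → sum (concat xss) ≡ sum (map sum xss)
  sum-concat []         = refl
  sum-concat (xs ∷ xss) = trans (sum-++ xs) (cong (sum xs +_) (sum-concat xss))

  matrix-total↔Fin : ∀ n k t → Σ (Vec (Vec ℕ k) n) (λ B → sum (map sum B) ≡ t) ↔ Fin (multichoose (n * k) t)
  matrix-total↔Fin n k t = ↔-trans
    (Σ-↔-irrelevant (concat-↔ n k) ℕ.≡-irrelevant ℕ.≡-irrelevant
      (λ B eq → trans (sum-concat B) eq)
      (λ xs eq → trans (sym (sum-concat (proj₁ (group n k xs)))) (trans (cong sum (sym (proj₂ (group n k xs)))) eq)))
    (Composition↔Fin (n * k) t)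

  columnSums : List (Vec ℕ m) → Vec ℕ m
  columnSums = List.foldr (zipWith _+_) (replicate _ 0)

  lookup-columnSums : ∀ (j : Fin m) vs → lookup (columnSums vs) j ≡ sumˡ (List.map (λ v → lookup v j) vs)
  lookup-columnSums j []       = lookup-replicate j 0
  lookup-columnSums j (v ∷ vs) = trans (lookup-zipWith _+_ j v (columnSums vs)) (cong (lookup v j +_) (lookup-columnSums j vs))

  sum-zipWith-+ : (u v : Vec ℕ m) → sum (zipWith _+_ u v) ≡ sum u + sum v
  sum-zipWith-+ []      []      = refl
  sum-zipWith-+ (x ∷ u) (y ∷ v) = begin
    x + y + sum (zipWith _+_ u v) ≡⟨ cong (x + y +_) (sum-zipWith-+ u v) ⟩
    x + y + (sum u + sum v)       ≡⟨ shuffle x y (sum u) (sum v) ⟩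
    x + sum u + (y + sum v)       ∎
    where
    open ≡-Reasoning
    shuffle : ∀ a b c d → a + b + (c + d) ≡ a + c + (b + d)
    shuffle = solve-∀

  sum-columnSums : (vs : List (Vec ℕ m)) → sum (columnSums vs) ≡ sumˡ (List.map sum vs)
  sum-columnSums {m} []       = sum-replicate-0 m
    where
    sum-replicate-0 : ∀ m → sum (replicate m 0) ≡ 0
    sum-replicate-0 zero    = refl
    sum-replicate-0 (suc m) = sum-replicate-0 m
  sum-columnSums (v ∷ vs) = trans (sum-zipWith-+ v (columnSums vs)) (cong (sum v +_) (sum-columnSums vs))

  columnSums-↭ : {vs ws : List (Vec ℕ m)} → vs ↭ ws → columnSums vs ≡ columnSums ws
  columnSums-↭ {vs = vs} {ws} vs↭ws = lookup-extensionality λ j →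
    trans (lookup-columnSums j vs) (trans (sum-↭ (↭.map⁺ (λ v → lookup v j) vs↭ws)) (sym (lookup-columnSums j ws)))

  Vec-≡-irrelevant : {u v : Vec ℕ n} → Irrelevant (u ≡ v)
  Vec-≡-irrelevant = Decidable⇒UIP.≡-irrelevant (≡-dec ℕ._≟_)

  Σ-×-↔ : {B : Set} {P : A → Set} {Q : B → Set} → Σ (A × B) (λ (a , b) → P a × Q b) ↔ (Σ A P × Σ B Q)
  Σ-×-↔ = mk↔ₛ′ (λ ((a , b) , p , q) → (a , p) , (b , q)) (λ ((a , p) , (b , q)) → (a , b) , p , q) (λ _ → refl) (λ _ → refl)

  map-head-zipWith : (h : Vec A n) (T : Vec (Vec A m) n) → map head (zipWith _∷_ h T) ≡ h
  map-head-zipWith []      []      = refl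
  map-head-zipWith (x ∷ h) (t ∷ T) = cong (x ∷_) (map-head-zipWith h T)

  map-tail-zipWith : (h : Vec A n) (T : Vec (Vec A m) n) → map tail (zipWith _∷_ h T) ≡ T
  map-tail-zipWith []      []      = refl
  map-tail-zipWith (x ∷ h) (t ∷ T) = cong (t ∷_) (map-tail-zipWith h T)

  zipWith-head-tail : (L : Vec (Vec A (suc m)) n) → zipWith _∷_ (map head L) (map tail L) ≡ L
  zipWith-head-tail []             = refl
  zipWith-head-tail ((x ∷ l) ∷ L) = cong ((x ∷ l) ∷_) (zipWith-head-tail L)

  head-tail-↔ : Vec (Vec A (suc m)) n ↔ (Vec A n × Vec (Vec A m) n)
  head-tail-↔ = mk↔ₛ′ (λ L → map head L , map tail L) (λ (h , T) → zipWith _∷_ h T)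
    (λ (h , T) → cong₂ _,_ (map-head-zipWith h T) (map-tail-zipWith h T)) zipWith-head-tail

  columnSums-head-tail : (L : Vec (Vec ℕ (suc m)) n) → columnSums (toList L) ≡ sum (map head L) ∷ columnSums (toList (map tail L))
  columnSums-head-tail []             = refl
  columnSums-head-tail ((x ∷ l) ∷ L) = cong (zipWith _+_ (x ∷ l)) (columnSums-head-tail L)

  multichoose-one : ∀ n → multichoose n 1 ≡ n
  multichoose-one zero    = refl
  multichoose-one (suc n) = trans (nC1≡n (n + 1)) (+-comm n 1)

  -- A matrix whose columns each sum to 1 is a choice of row for every column.
  unit-columns↔Fin : ∀ m n → Σ (Vec (Vec ℕ m) n) (λ L → columnSums (toList L) ≡ replicate m 1) ↔ Fin (n ^ m)
  unit-columns↔Fin zero n = mk↔ₛ′ (λ _ → zero) (λ _ → replicate n [] , nil-unique _ _) (λ { zero → refl })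
    (λ (L , _) → Σ-≡-irrelevant Vec-≡-irrelevant (lookup-extensionality λ _ → nil-unique _ _))
    where
    nil-unique : (u v : Vec A 0) → u ≡ v
    nil-unique [] [] = refl
  unit-columns↔Fin (suc m) n = begin
    Σ (Vec (Vec ℕ (suc m)) n) (λ L → columnSums (toList L) ≡ 1 ∷ replicate m 1)
      ↔⟨ Σ-↔-irrelevant head-tail-↔ Vec-≡-irrelevant (λ {_} → ×-irrelevant ℕ.≡-irrelevant Vec-≡-irrelevant)
           (λ L eq → ∷-injective (trans (sym (columnSums-head-tail L)) eq))
           (λ (h , T) (sum≡1 , cols≡1) → trans (columnSums-head-tail (zipWith _∷_ h T))
                                           (cong₂ _∷_ (trans (cong sum (map-head-zipWith h T)) sum≡1)
                                                      (trans (cong (columnSums ∘ toList) (map-tail-zipWith h T)) cols≡1))) ⟩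
    Σ (Vec ℕ n × Vec (Vec ℕ m) n) (λ (h , T) → sum h ≡ 1 × columnSums (toList T) ≡ replicate m 1)
      ↔⟨ Σ-×-↔ ⟩
    (Composition n 1 × Σ (Vec (Vec ℕ m) n) (λ T → columnSums (toList T) ≡ replicate m 1))
      ↔⟨ Composition↔Fin n 1 ×-↔ unit-columns↔Fin m n ⟩
    (Fin (multichoose n 1) × Fin (n ^ m))
      ≡⟨ cong (λ c → Fin c × Fin (n ^ m)) (multichoose-one n) ⟩
    (Fin n × Fin (n ^ m))
      ↔⟨ ↔-sym *↔× ⟩
    Fin (n ^ suc m) ∎
    where open ↔-Reasoning

  take-drop-++ : ∀ {k i} (xs : Vec A k) (ys : Vec A i) → take k (xs ++ ys) ≡ xs × drop k (xs ++ ys) ≡ ys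
  take-drop-++ {k = k} xs ys = ++-injective (take k (xs ++ ys)) xs (take++drop≡id k (xs ++ ys))

  split-columns-↔ : ∀ k i → Vec (Vec A (k + i)) n ↔ (Vec (Vec A k) n × Vec (Vec A i) n)
  split-columns-↔ k i = mk↔ₛ′ (λ V → map (take k) V , map (drop k) V) (λ (B , L) → zipWith _++_ B L)
    (λ (B , L) → split-join B L) join-split
    where
    split-join : ∀ {n} (B : Vec (Vec _ k) n) (L : Vec (Vec _ i) n) → (map (take k) (zipWith _++_ B L) , map (drop k) (zipWith _++_ B L)) ≡ (B , L)
    split-join []      []      = refl
    split-join (b ∷ B) (l ∷ L) = cong₂ (λ (b′ , l′) (B′ , L′) → (b′ ∷ B′ , l′ ∷ L′))
      (cong₂ _,_ (proj₁ (take-drop-++ b l)) (proj₂ (take-drop-++ b l))) (split-join B L)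
    join-split : ∀ {n} (V : Vec (Vec _ (k + i)) n) → zipWith _++_ (map (take k) V) (map (drop k) V) ≡ V
    join-split []      = refl
    join-split (v ∷ V) = cong₂ _∷_ (take++drop≡id k v) (join-split V)

module CycleLemma where

  open import Data.Bool using (Bool; true; false)
  open import Data.Fin using (Fin; toℕ; fromℕ<)
  open import Data.Fin.Properties using (toℕ-fromℕ<; toℕ-injective; toℕ<n)
  open import Data.List using (List; []; _∷_; _++_; length; map; take; drop)
  open import Data.List.Properties using (map-++; take-map; drop-map; take++drop≡id; take-all; drop-all; drop-drop; take-take; length-drop; ++-assoc; length-map)
  open import Data.List.Relation.Binary.Permutation.Propositional using (_↭_; ↭-trans; ↭-reflexive)
  open import Data.List.Relation.Binary.Permutation.Propositional.Properties using (++-comm; ↭-length)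
  open import Data.Nat using (ℕ; zero; suc; _+_; _∸_; _≤_; _<_; z≤n; s≤s)
  open import Data.Nat.ListAction using (sum)
  open import Data.Nat.ListAction.Properties using (sum-++)
  open import Data.Nat.Properties
  open import Data.Nat.Tactic.RingSolver using (solve-∀)
  open import Data.Product using (Σ; _×_; _,_; proj₁; proj₂)
  open import Data.Sum using (inj₁; inj₂)
  open import Function.Bundles using (_↔_; mk↔ₛ′)
  open import Relation.Binary.Definitions using (tri<; tri≈; tri>)
  open import Relation.Binary.PropositionalEquality using (_≡_; refl; sym; trans; cong; cong₂; subst; subst₂; module ≡-Reasoning)
  open import Relation.Nullary using (¬_; contradiction; yes; no; Irrelevant)

  open Cardinalities using (≡true-irrelevant; ×-irrelevant; Σ-≡-irrelevant)

  private variable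
    A : Set

  take-++-≤ : ∀ t (xs ys : List A) → t ≤ length xs → take t (xs ++ ys) ≡ take t xs
  take-++-≤ zero    xs       ys _         = refl
  take-++-≤ (suc t) (x ∷ xs) ys (s≤s t≤) = cong (x ∷_) (take-++-≤ t xs ys t≤)

  drop-++-≤ : ∀ t (xs ys : List A) → t ≤ length xs → drop t (xs ++ ys) ≡ drop t xs ++ ys
  drop-++-≤ zero    xs       ys _         = refl
  drop-++-≤ (suc t) (x ∷ xs) ys (s≤s t≤) = drop-++-≤ t xs ys t≤

  take-length-+-++ : ∀ (xs ys : List A) u → take (length xs + u) (xs ++ ys) ≡ xs ++ take u ys
  take-length-+-++ []       ys u = refl
  take-length-+-++ (x ∷ xs) ys u = cong (x ∷_) (take-length-+-++ xs ys u)

  take-+ : ∀ a b (xs : List A) → take (a + b) xs ≡ take a xs ++ take b (drop a xs)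
  take-+ zero    b xs       = refl
  take-+ (suc a) zero    [] = refl
  take-+ (suc a) (suc b) [] = refl
  take-+ (suc a) b (x ∷ xs) = cong (x ∷_) (take-+ a b xs)

  +-length-drop : ∀ t (xs : List A) → t ≤ length xs → t + length (drop t xs) ≡ length xs
  +-length-drop t xs t≤ = trans (cong (t +_) (length-drop t xs)) (m+[n∸m]≡n t≤)

  rotate : ℕ → List A → List A
  rotate j xs = drop j xs ++ take j xs

  rotate-↭ : ∀ j (xs : List A) → rotate j xs ↭ xs
  rotate-↭ j xs = ↭-trans (++-comm (drop j xs) (take j xs)) (↭-reflexive (take++drop≡id j xs))

  length-rotate : ∀ j (xs : List A) → length (rotate j xs) ≡ length xs
  length-rotate j xs = ↭-length (rotate-↭ j xs)

  map-rotate : ∀ {B : Set} (f : A → B) j xs → map f (rotate j xs) ≡ rotate j (map f xs)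
  map-rotate f j xs = trans (map-++ f (drop j xs) (take j xs)) (cong₂ _++_ (sym (drop-map j xs)) (sym (take-map j xs)))

  rotate-length : (xs : List A) → rotate (length xs) xs ≡ xs
  rotate-length xs = cong₂ _++_ (drop-all (length xs) xs ≤-refl) (take-all (length xs) xs ≤-refl)

  rotate-rotate : ∀ i j (xs : List A) → i + j ≤ length xs → rotate j (rotate i xs) ≡ rotate (i + j) xs
  rotate-rotate i j xs i+j≤ = begin
    drop j (drop i xs ++ take i xs) ++ take j (drop i xs ++ take i xs)
      ≡⟨ cong₂ _++_ (drop-++-≤ j (drop i xs) (take i xs) j≤) (take-++-≤ j (drop i xs) (take i xs) j≤) ⟩
    (drop j (drop i xs) ++ take i xs) ++ take j (drop i xs)
      ≡⟨ ++-assoc (drop j (drop i xs)) (take i xs) (take j (drop i xs)) ⟩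
    drop j (drop i xs) ++ (take i xs ++ take j (drop i xs))
      ≡⟨ cong₂ _++_ (drop-drop i j xs) (sym (take-+ i j xs)) ⟩
    drop (i + j) xs ++ take (i + j) xs ∎
    where
    open ≡-Reasoning
    j≤ : j ≤ length (drop i xs)
    j≤ = +-cancelˡ-≤ i j _ (subst (i + j ≤_) (sym (+-length-drop i xs (m+n≤o⇒m≤o i i+j≤))) i+j≤)

  rotate-rotate-length : ∀ i j (xs : List A) → i + j ≡ length xs → rotate j (rotate i xs) ≡ xs
  rotate-rotate-length i j xs i+j≡n =
    trans (rotate-rotate i j xs (≤-reflexive i+j≡n)) (trans (cong (λ t → rotate t xs) i+j≡n) (rotate-length xs))

  rotate-rotate-wrap : ∀ i j u (xs : List A) → i ≤ length xs → j ≤ length xs →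
                       length xs + u ≡ i + j → rotate j (rotate i xs) ≡ rotate u xs
  rotate-rotate-wrap i j u xs i≤ j≤ n+u≡i+j = begin
    rotate j (rotate i xs)            ≡⟨ cong (λ t → rotate t (rotate i xs)) j≡e+u ⟩
    rotate (e + u) (rotate i xs)      ≡⟨ sym (rotate-rotate e u (rotate i xs) e+u≤) ⟩
    rotate u (rotate e (rotate i xs)) ≡⟨ cong (rotate u) (rotate-rotate-length i e xs i+e≡n) ⟩
    rotate u xs                       ∎
    where
    open ≡-Reasoning
    e : ℕ
    e = length (drop i xs)
    i+e≡n : i + e ≡ length xs
    i+e≡n = +-length-drop i xs i≤
    j≡e+u : j ≡ e + u
    j≡e+u = +-cancelˡ-≡ i j (e + u) (trans (sym n+u≡i+j) (trans (cong (_+ u) (sym i+e≡n)) (+-assoc i e u)))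
    e+u≤ : e + u ≤ length (rotate i xs)
    e+u≤ = subst₂ _≤_ j≡e+u (sym (length-rotate i xs)) j≤

  prefix : ℕ → List ℕ → ℕ
  prefix t xs = sum (take t xs)

  prefix-+ : ∀ a b xs → prefix (a + b) xs ≡ prefix a xs + prefix b (drop a xs)
  prefix-+ a b xs = trans (cong sum (take-+ a b xs)) (sum-++ (take a xs) _)

  prefix-+-sum-drop : ∀ j xs → prefix j xs + sum (drop j xs) ≡ sum xs
  prefix-+-sum-drop j xs = trans (sym (sum-++ (take j xs) (drop j xs))) (cong sum (take++drop≡id j xs))

  prefix-rotate : ∀ j t xs → j + t ≤ length xs → prefix j xs + prefix t (rotate j xs) ≡ prefix (j + t) xs
  prefix-rotate j t xs j+t≤ = begin
    prefix j xs + prefix t (drop j xs ++ take j xs) ≡⟨ cong (λ ys → prefix j xs + sum ys) (take-++-≤ t (drop j xs) (take j xs) t≤) ⟩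
    prefix j xs + prefix t (drop j xs)              ≡⟨ sym (prefix-+ j t xs) ⟩
    prefix (j + t) xs                               ∎
    where
    open ≡-Reasoning
    t≤ : t ≤ length (drop j xs)
    t≤ = +-cancelˡ-≤ j t _ (subst (j + t ≤_) (sym (+-length-drop j xs (m+n≤o⇒m≤o j j+t≤))) j+t≤)

  prefix-rotate-wrap : ∀ j u xs → u ≤ j →
                       prefix j xs + prefix (length (drop j xs) + u) (rotate j xs) ≡ sum xs + prefix u xs
  prefix-rotate-wrap j u xs u≤j = begin
    prefix j xs + sum (take (length (drop j xs) + u) (drop j xs ++ take j xs))
      ≡⟨ cong (λ ys → prefix j xs + sum ys) (take-length-+-++ (drop j xs) (take j xs) u) ⟩
    prefix j xs + sum (drop j xs ++ take u (take j xs))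
      ≡⟨ cong (λ ys → prefix j xs + sum (drop j xs ++ ys)) (trans (take-take u j xs) (cong (λ t → take t xs) (m≤n⇒m⊓n≡m u≤j))) ⟩
    prefix j xs + sum (drop j xs ++ take u xs)
      ≡⟨ cong (prefix j xs +_) (sum-++ (drop j xs) (take u xs)) ⟩
    prefix j xs + (sum (drop j xs) + prefix u xs)
      ≡⟨ sym (+-assoc (prefix j xs) _ _) ⟩
    prefix j xs + sum (drop j xs) + prefix u xs
      ≡⟨ cong (_+ prefix u xs) (prefix-+-sum-drop j xs) ⟩
    sum xs + prefix u xs ∎
    where open ≡-Reasoning

  -- Both say that the path N^x₀ E N^x₁ E ⋯ E N^xₗ started at height h stays weakly above the diagonal.

  Above : ℕ → List ℕ → Set
  Above h xs = ∀ t → t < length xs → t ≤ h + prefix t xs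

  mutual
    runsAbove : ℕ → List ℕ → Bool
    runsAbove h []           = true
    runsAbove h (x ∷ [])     = true
    runsAbove h (x ∷ y ∷ ys) = eastAbove (h + x) (y ∷ ys)

    eastAbove : ℕ → List ℕ → Bool
    eastAbove zero    ys = false
    eastAbove (suc h) ys = runsAbove h ys

  mutual
    runsAbove⇒Above : ∀ h xs → runsAbove h xs ≡ true → Above h xs
    runsAbove⇒Above h xs           g zero    _        = z≤n
    runsAbove⇒Above h (x ∷ y ∷ ys) g (suc t) (s≤s t<) =
      subst (suc t ≤_) (+-assoc h x (prefix t (y ∷ ys))) (eastAbove⇒Above (h + x) (y ∷ ys) g t t<)

    eastAbove⇒Above : ∀ h ys → eastAbove h ys ≡ true → ∀ t → t < length ys → suc t ≤ h + prefix t ys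
    eastAbove⇒Above (suc h) ys g t t< = s≤s (runsAbove⇒Above h ys g t t<)

  mutual
    Above⇒runsAbove : ∀ h xs → Above h xs → runsAbove h xs ≡ true
    Above⇒runsAbove h []           a = refl
    Above⇒runsAbove h (x ∷ [])     a = refl
    Above⇒runsAbove h (x ∷ y ∷ ys) a = Above⇒eastAbove (h + x) (y ∷ ys) (s≤s z≤n) λ t t< →
      subst (suc t ≤_) (sym (+-assoc h x (prefix t (y ∷ ys)))) (a (suc t) (s≤s t<))

    Above⇒eastAbove : ∀ h ys → 0 < length ys → (∀ t → t < length ys → suc t ≤ h + prefix t ys) →
                      eastAbove h ys ≡ true
    Above⇒eastAbove zero    ys 0<n a = contradiction (a 0 0<n) λ ()
    Above⇒eastAbove (suc h) ys _   a = Above⇒runsAbove h ys λ t t< → ≤-pred (a t t<)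

  -- The least maximiser of the integer-valued t ↦ t - f t on 1 ≤ t ≤ n;
  -- a - b < c - d is written a + d < c + b to stay in ℕ.
  record LeastMaximiser (f : ℕ → ℕ) (n : ℕ) : Set where
    field
      j        : ℕ
      1≤j      : 1 ≤ j
      j≤n      : j ≤ n
      <-before : ∀ t → 1 ≤ t → t < j → t + f j < j + f t
      ≤-after  : ∀ t → j ≤ t → t ≤ n → t + f j ≤ j + f t

  difference-≤-<-trans : ∀ a b c d e f → a + d ≤ c + b → c + f < e + d → a + f < e + b
  difference-≤-<-trans a b c d e f ab≤cd cd<ef = +-cancelʳ-< (c + d) (a + f) (e + b)
    (subst₂ _<_ (shuffle a d c f) (trans (shuffle c b e d) (+-comm (c + d) (e + b))) (+-mono-≤-< ab≤cd cd<ef))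
    where
    shuffle : ∀ x y z w → (x + y) + (z + w) ≡ (x + w) + (z + y)
    shuffle = solve-∀

  leastMaximiser : ∀ f m → LeastMaximiser f (suc m)
  leastMaximiser f zero = record
    { j = 1 ; 1≤j = ≤-refl ; j≤n = ≤-refl
    ; <-before = λ t 1≤t t<1 → contradiction (≤-<-trans 1≤t t<1) (<-irrefl refl)
    ; ≤-after  = λ t 1≤t t≤1 → subst (λ s → s + f 1 ≤ 1 + f s) (≤-antisym 1≤t t≤1) ≤-refl }
  leastMaximiser f (suc m) with leastMaximiser f m
  ... | M with suc (suc m) + f (LeastMaximiser.j M) ≤? LeastMaximiser.j M + f (suc (suc m))
  ...   | yes n≤j = record
    { j = j ; 1≤j = 1≤j ; j≤n = m≤n⇒m≤1+n j≤n ; <-before = <-before ; ≤-after = after }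
    where
    open LeastMaximiser M
    after : ∀ t → j ≤ t → t ≤ suc (suc m) → t + f j ≤ j + f t
    after t j≤t t≤n with m≤n⇒m<n∨m≡n t≤n
    ... | inj₁ t<n  = ≤-after t j≤t (≤-pred t<n)
    ... | inj₂ refl = n≤j
  ...   | no n≰j = record
    { j = suc (suc m) ; 1≤j = s≤s z≤n ; j≤n = ≤-refl ; <-before = before
    ; ≤-after = λ t n≤t t≤n → subst (λ s → s + f (suc (suc m)) ≤ suc (suc m) + f s) (≤-antisym n≤t t≤n) ≤-refl }
    where
    open LeastMaximiser M
    j<n : j + f (suc (suc m)) < suc (suc m) + f j
    j<n = ≰⇒> n≰j
    before : ∀ t → 1 ≤ t → t < suc (suc m) → t + f (suc (suc m)) < suc (suc m) + f t
    before t 1≤t t<n with t <? j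
    ... | yes t<j = difference-≤-<-trans t (f t) j (f j) _ _ (<⇒≤ (<-before t 1≤t t<j)) j<n
    ... | no  t≮j = difference-≤-<-trans t (f t) j (f j) _ _ (≤-after t (≮⇒≥ t≮j) (≤-pred t<n)) j<n

  -- At a second good cut d the two prefix conditions add up to length xs ≤ sum xs.
  Above-rotate-unique : ∀ xs d → suc (sum xs) ≡ length xs → Above 0 xs → 0 < d → d < length xs →
                        ¬ Above 0 (rotate d xs)
  Above-rotate-unique xs d 1+sum≡n above 0<d d<n above′ = <-irrefl refl (begin-strict
    sum xs                                      <⟨ n<1+n (sum xs) ⟩
    suc (sum xs)                                ≡⟨ 1+sum≡n ⟩
    length xs                                   ≡⟨ sym d+e≡n ⟩
    d + e                                       ≤⟨ +-mono-≤ (above d d<n) (above′ e e<n) ⟩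
    prefix d xs + prefix e (rotate d xs)        ≡⟨ cong (λ t → prefix d xs + prefix t (rotate d xs)) (sym (+-identityʳ e)) ⟩
    prefix d xs + prefix (e + 0) (rotate d xs)  ≡⟨ prefix-rotate-wrap d 0 xs z≤n ⟩
    sum xs + 0                                  ≡⟨ +-identityʳ (sum xs) ⟩
    sum xs                                      ∎)
    where
    open ≤-Reasoning
    e : ℕ
    e = length (drop d xs)
    d+e≡n : d + e ≡ length xs
    d+e≡n = +-length-drop d xs (<⇒≤ d<n)
    e<n : e < length (rotate d xs)
    e<n = subst (e <_) (trans d+e≡n (sym (length-rotate d xs))) (m<n+m e 0<d)

  module _ (xs : List ℕ) (1+sum≡n : suc (sum xs) ≡ length xs)
           (M : LeastMaximiser (λ t → prefix t xs) (suc (sum xs))) where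
    open LeastMaximiser M

    private
      e : ℕ
      e = length (drop j xs)
      j+e≡n : j + e ≡ length xs
      j+e≡n = +-length-drop j xs (subst (j ≤_) 1+sum≡n j≤n)
      swap-+ : ∀ a b c → a + (b + c) ≡ b + a + c
      swap-+ = solve-∀
      rotate-+ : ∀ a b c → a + (b + c) ≡ c + (a + b)
      rotate-+ = solve-∀
      +-suc-assoc : ∀ a b c → a + suc (b + c) ≡ suc (a + b + c)
      +-suc-assoc = solve-∀

    prefix-rotate-maximiser : ∀ t → j + t ≤ length xs → t ≤ prefix t (rotate j xs)
    prefix-rotate-maximiser t j+t≤n = +-cancelʳ-≤ (j + prefix j xs) t _ (begin
      t + (j + prefix j xs)                      ≡⟨ swap-+ t j (prefix j xs) ⟩
      j + t + prefix j xs                        ≤⟨ ≤-after (j + t) (m≤m+n j t) (subst (j + t ≤_) (sym 1+sum≡n) j+t≤n) ⟩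
      j + prefix (j + t) xs                      ≡⟨ cong (j +_) (sym (prefix-rotate j t xs j+t≤n)) ⟩
      j + (prefix j xs + prefix t (rotate j xs)) ≡⟨ rotate-+ j (prefix j xs) (prefix t (rotate j xs)) ⟩
      prefix t (rotate j xs) + (j + prefix j xs) ∎)
      where open ≤-Reasoning

    prefix-rotate-maximiser-wrap : ∀ u → 1 ≤ u → u < j → e + u ≤ prefix (e + u) (rotate j xs)
    prefix-rotate-maximiser-wrap u 1≤u u<j = +-cancelʳ-≤ (prefix j xs) (e + u) _ (≤-pred (begin
      suc (e + u + prefix j xs)                        ≡⟨ sym (+-suc-assoc e u (prefix j xs)) ⟩
      e + suc (u + prefix j xs)                        ≤⟨ +-monoʳ-≤ e (<-before u 1≤u u<j) ⟩
      e + (j + prefix u xs)                            ≡⟨ swap-+ e j (prefix u xs) ⟩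
      j + e + prefix u xs                              ≡⟨ cong (_+ prefix u xs) (trans j+e≡n (sym 1+sum≡n)) ⟩
      suc (sum xs + prefix u xs)                       ≡⟨ cong suc (sym (prefix-rotate-wrap j u xs (<⇒≤ u<j))) ⟩
      suc (prefix j xs + prefix (e + u) (rotate j xs)) ≡⟨ cong suc (+-comm (prefix j xs) _) ⟩
      suc (prefix (e + u) (rotate j xs) + prefix j xs) ∎))
      where open ≤-Reasoning

    -- Prefixes of the rotation that end inside drop j xs are long enough by maximality of j,
    -- those that wrap around by strict maximality.
    Above-rotate-maximiser : Above 0 (rotate j xs)
    Above-rotate-maximiser t t<n with j + t ≤? length xs
    ... | yes j+t≤n = prefix-rotate-maximiser t j+t≤n
    ... | no  j+t≰n = subst (λ s → s ≤ prefix s (rotate j xs)) e+u≡t (prefix-rotate-maximiser-wrap u 1≤u u<j)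
      where
      e<t : e < t
      e<t = +-cancelˡ-< j e t (subst (_< j + t) (sym j+e≡n) (≰⇒> j+t≰n))
      u : ℕ
      u = t ∸ e
      e+u≡t : e + u ≡ t
      e+u≡t = m+[n∸m]≡n (<⇒≤ e<t)
      1≤u : 1 ≤ u
      1≤u = +-cancelˡ-≤ e 1 u (subst (_≤ e + u) (+-comm 1 e) (subst (suc e ≤_) (sym e+u≡t) e<t))
      u<j : u < j
      u<j = +-cancelˡ-< e u j (subst₂ _<_ (sym e+u≡t) (trans (sym j+e≡n) (+-comm j e))
                                 (subst (t <_) (length-rotate j xs) t<n))

  Above-rotate-exists : ∀ xs → suc (sum xs) ≡ length xs → Σ ℕ λ j → 1 ≤ j × j ≤ length xs × Above 0 (rotate j xs)
  Above-rotate-exists xs 1+sum≡n = j , 1≤j , subst (j ≤_) 1+sum≡n j≤n , Above-rotate-maximiser xs 1+sum≡n M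
    where
    M : LeastMaximiser (λ t → prefix t xs) (suc (sum xs))
    M = leastMaximiser (λ t → prefix t xs) (sum xs)
    open LeastMaximiser M

  Above-rotate-rotate : ∀ xs j c → suc (sum xs) ≡ length xs → Above 0 xs → j < length xs → 0 < c → c ≤ length xs →
                        Above 0 (rotate c (rotate j xs)) → j + c ≡ length xs
  Above-rotate-rotate xs j c 1+sum≡n above j<n 0<c c≤n above′ with <-cmp (j + c) (length xs)
  ... | tri≈ _ j+c≡n _ = j+c≡n
  ... | tri< j+c<n _ _ = contradiction (subst (Above 0) (rotate-rotate j c xs (<⇒≤ j+c<n)) above′)
                           (Above-rotate-unique xs (j + c) 1+sum≡n above (<-≤-trans 0<c (m≤n+m c j)) j+c<n)
  ... | tri> _ _ n<j+c = contradiction (subst (Above 0) (rotate-rotate-wrap j c u xs (<⇒≤ j<n) c≤n n+u≡j+c) above′)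
                           (Above-rotate-unique xs u 1+sum≡n above 0<u u<n)
    where
    u : ℕ
    u = j + c ∸ length xs
    n+u≡j+c : length xs + u ≡ j + c
    n+u≡j+c = m+[n∸m]≡n (<⇒≤ n<j+c)
    0<u : 0 < u
    0<u = m<n⇒0<n∸m n<j+c
    u<n : u < length xs
    u<n = +-cancelˡ-< (length xs) u (length xs) (subst (_< length xs + length xs) (sym n+u≡j+c) (+-mono-<-≤ j<n c≤n))

  module Cycle {A : Set} (size : A → ℕ) (r : ℕ) (P : List A → Set)
    (P-irrelevant : ∀ {xs} → Irrelevant (P xs))
    (P-rotate : ∀ j xs → P xs → P (rotate j xs))
    (P-length : ∀ xs → P xs → length xs ≡ suc r)
    (P-sum : ∀ xs → P xs → sum (map size xs) ≡ r) where

    Good : List A → Set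
    Good xs = P xs × runsAbove 0 (map size xs) ≡ true

    Good-irrelevant : ∀ {xs} → Irrelevant (Good xs)
    Good-irrelevant = ×-irrelevant P-irrelevant ≡true-irrelevant

    private
      1+sum≡length : ∀ xs → P xs → suc (sum (map size xs)) ≡ length (map size xs)
      1+sum≡length xs p = trans (cong suc (P-sum xs p)) (sym (trans (length-map size xs) (P-length xs p)))

      Above-map-rotate : ∀ j xs → Above 0 (rotate j (map size xs)) → Above 0 (map size (rotate j xs))
      Above-map-rotate j xs = subst (Above 0) (sym (map-rotate size j xs))

    record GoodRotation (xs : List A) : Set where
      field
        shift   : ℕ
        1≤shift : 1 ≤ shift
        shift≤n : shift ≤ suc r
        rotated : Good (rotate shift xs)

    good-rotation : ∀ xs → P xs → GoodRotation xs
    good-rotation xs p with Above-rotate-exists (map size xs) (1+sum≡length xs p)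
    ... | c , 1≤c , c≤n , above = record
      { shift = c ; 1≤shift = 1≤c ; shift≤n = subst (c ≤_) (trans (length-map size xs) (P-length xs p)) c≤n
      ; rotated = P-rotate c xs p , Above⇒runsAbove 0 _ (Above-map-rotate c xs above) }

    good-rotation-shift : ∀ xs j → Good xs → j < suc r → (R : GoodRotation (rotate j xs)) → j + GoodRotation.shift R ≡ suc r
    good-rotation-shift xs j (p , g) j<n R = trans
      (Above-rotate-rotate (map size xs) j c (1+sum≡length xs p) (runsAbove⇒Above 0 _ g)
        (subst (j <_) n≡length j<n) 1≤c (subst (c ≤_) n≡length c≤n)
        (subst (Above 0) (trans (map-rotate size c (rotate j xs)) (cong (rotate c) (map-rotate size j xs)))
          (runsAbove⇒Above 0 _ (proj₂ rotated))))
      (sym n≡length)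
      where
      open GoodRotation R renaming (shift to c; 1≤shift to 1≤c; shift≤n to c≤n)
      n≡length : suc r ≡ length (map size xs)
      n≡length = sym (trans (length-map size xs) (P-length xs p))

    cycle-↔ : (Σ (List A) Good × Fin (suc r)) ↔ Σ (List A) P
    cycle-↔ = mk↔ₛ′ to from to∘from from∘to
      where
      to : Σ (List A) Good × Fin (suc r) → Σ (List A) P
      to ((xs , p , _) , j) = rotate (toℕ j) xs , P-rotate (toℕ j) xs p

      from : Σ (List A) P → Σ (List A) Good × Fin (suc r)
      from (xs , p) = (rotate shift xs , rotated) , fromℕ< (∸-monoʳ-< 1≤shift shift≤n)
        where open GoodRotation (good-rotation xs p)

      to∘from : ∀ y → to (from y) ≡ y
      to∘from (xs , p) = Σ-≡-irrelevant P-irrelevant (begin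
        rotate (toℕ (fromℕ< (∸-monoʳ-< 1≤c c≤n))) (rotate c xs) ≡⟨ cong (λ t → rotate t (rotate c xs)) (toℕ-fromℕ< (∸-monoʳ-< 1≤c c≤n)) ⟩
        rotate (suc r ∸ c) (rotate c xs)                       ≡⟨ rotate-rotate-length c (suc r ∸ c) xs c+[n∸c]≡length ⟩
        xs                                                     ∎)
        where
        open ≡-Reasoning
        open GoodRotation (good-rotation xs p) renaming (shift to c; 1≤shift to 1≤c; shift≤n to c≤n)
        c+[n∸c]≡length : c + (suc r ∸ c) ≡ length xs
        c+[n∸c]≡length = trans (m+[n∸m]≡n c≤n) (sym (P-length xs p))

      from∘to : ∀ x → from (to x) ≡ x
      from∘to ((xs , good) , j) = cong₂ _,_
        (Σ-≡-irrelevant Good-irrelevant (rotate-rotate-length (toℕ j) c xs (trans j+c≡n (sym (P-length xs (proj₁ good))))))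
        (toℕ-injective (trans (toℕ-fromℕ< (∸-monoʳ-< 1≤c c≤n)) (trans (cong (_∸ c) (sym j+c≡n)) (m+n∸n≡m (toℕ j) c))))
        where
        R : GoodRotation (rotate (toℕ j) xs)
        R = good-rotation (rotate (toℕ j) xs) (P-rotate (toℕ j) xs (proj₁ good))
        open GoodRotation R renaming (shift to c; 1≤shift to 1≤c; shift≤n to c≤n)
        j+c≡n : toℕ j + c ≡ suc r
        j+c≡n = good-rotation-shift xs (toℕ j) good (toℕ<n j) R

module Labels where

  open import Data.Bool using (true; false; if_then_else_)
  open import Data.Bool.Properties using (T-≡)
  open import Data.Fin using (Fin; zero; suc; toℕ; opposite; splitAt; join; _↑ˡ_; _↑ʳ_) renaming (_≤_ to _≤ᶠ_)
  open import Data.Fin.Properties using (toℕ-↑ˡ; toℕ-↑ʳ; toℕ<n; opposite-prop; opposite-involutive; splitAt-↑ˡ; splitAt-↑ʳ; join-splitAt) renaming (_≟_ to _≟ᶠ_)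
  open import Data.List using (List; []; _∷_; _++_; map; replicate; foldr; length)
  open import Data.List.Properties using (length-++; length-map; length-replicate; foldr-++)
  open import Data.List.Relation.Unary.All as All using (All; []; _∷_)
  import Data.List.Relation.Unary.All.Properties as AllP
  open import Data.List.Relation.Unary.Linked as Linked using (Linked; []; [-]; _∷_)
  import Data.List.Relation.Unary.Linked.Properties as LinkedP
  open import Data.Nat using (ℕ; zero; suc; _+_; _∸_; _≤_; _<_; _≤ᵇ_; z≤n; s≤s)
  open import Data.Nat.Properties
  open import Data.Product using (_,_)
  open import Data.Sum using (inj₁; inj₂; [_,_]′)
  open import Data.Vec using (Vec; []; _∷_; sum; lookup; updateAt) renaming (replicate to replicateᵛ)
  open import Function using (_∘_)
  open import Function.Bundles using (Equivalence)
  open import Relation.Binary.PropositionalEquality using (_≡_; refl; sym; trans; cong; cong₂; subst; subst₂; module ≡-Reasoning)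
  open import Relation.Nullary using (Dec; does; yes; no; contradiction)
  open import Relation.Nullary.Decidable using (dec-true; dec-false)

  open import Defs using (Label; bar; lab; _≤L_)

  ≤ᵇ≡true⇒≤ : ∀ m n → (m ≤ᵇ n) ≡ true → m ≤ n
  ≤ᵇ≡true⇒≤ m n eq = ≤ᵇ⇒≤ m n (Equivalence.from T-≡ eq)

  ≤⇒≤ᵇ≡true : ∀ {m n} → m ≤ n → (m ≤ᵇ n) ≡ true
  ≤⇒≤ᵇ≡true m≤n = Equivalence.to T-≡ (≤⇒≤ᵇ m≤n)

  does-⇔ : {A B : Set} (a? : Dec A) (b? : Dec B) → (A → B) → (B → A) → does a? ≡ does b?
  does-⇔ (yes a) b? f g = sym (dec-true b? (f a))
  does-⇔ (no ¬a) b? f g = sym (dec-false b? (¬a ∘ g))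

  -- Labels sit in Fin (k + i) in the order of ≤L: bar (k - 1), …, bar 0, lab 0, …, lab (i - 1).

  module Positions (k i : ℕ) where

    position : Label k i → Fin (k + i)
    position (bar q) = opposite q ↑ˡ i
    position (lab q) = k ↑ʳ q

    label : Fin (k + i) → Label k i
    label p = [ bar ∘ opposite , lab ]′ (splitAt k p)

    label-position : ∀ a → label (position a) ≡ a
    label-position (bar q) = trans (cong [ bar ∘ opposite , lab ]′ (splitAt-↑ˡ k (opposite q) i))
                                   (cong bar (opposite-involutive q))
    label-position (lab q) = cong [ bar ∘ opposite , lab ]′ (splitAt-↑ʳ k i q)

    position-label : ∀ p → position (label p) ≡ p
    position-label p with splitAt k p in split≡
    ... | inj₁ q = trans (cong (_↑ˡ i) (opposite-involutive q)) (trans (cong (join k i) (sym split≡)) (join-splitAt k i p))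
    ... | inj₂ q = trans (cong (join k i) (sym split≡)) (join-splitAt k i p)

    toℕ-position-bar : ∀ q → toℕ (position (bar q)) ≡ k ∸ suc (toℕ q)
    toℕ-position-bar q = trans (toℕ-↑ˡ (opposite q) i) (opposite-prop q)

    toℕ-position-lab : ∀ q → toℕ (position (lab q)) ≡ k + toℕ q
    toℕ-position-lab q = toℕ-↑ʳ k q

    position-bar<k : ∀ q → toℕ (position (bar q)) < k
    position-bar<k q = subst (_< k) (sym (toℕ-↑ˡ (opposite q) i)) (toℕ<n (opposite q))

    k≤position-lab : ∀ q → k ≤ toℕ (position (lab q))
    k≤position-lab q = subst (k ≤_) (sym (toℕ-position-lab q)) (m≤m+n k (toℕ q))

    ≤L⇒≤-position : ∀ a b → (a ≤L b) ≡ true → position a ≤ᶠ position b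
    ≤L⇒≤-position (bar p) (bar q) q≤p = subst₂ _≤_ (sym (toℕ-position-bar p)) (sym (toℕ-position-bar q))
                                          (∸-monoʳ-≤ k (s≤s (≤ᵇ≡true⇒≤ _ _ q≤p)))
    ≤L⇒≤-position (bar p) (lab q) _   = <⇒≤ (<-≤-trans (position-bar<k p) (k≤position-lab q))
    ≤L⇒≤-position (lab p) (lab q) p≤q = subst₂ _≤_ (sym (toℕ-position-lab p)) (sym (toℕ-position-lab q))
                                          (+-monoʳ-≤ k (≤ᵇ≡true⇒≤ _ _ p≤q))

    ≤-position⇒≤L : ∀ a b → position a ≤ᶠ position b → (a ≤L b) ≡ true
    ≤-position⇒≤L (bar p) (bar q) ≤pos = ≤⇒≤ᵇ≡true (≤-pred (∸-cancelʳ-≤ (toℕ<n q)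
                                            (subst₂ _≤_ (toℕ-position-bar p) (toℕ-position-bar q) ≤pos)))
    ≤-position⇒≤L (bar p) (lab q) _    = refl
    ≤-position⇒≤L (lab p) (bar q) ≤pos = contradiction (≤-<-trans (≤-trans (k≤position-lab p) ≤pos) (position-bar<k q)) (<-irrefl refl)
    ≤-position⇒≤L (lab p) (lab q) ≤pos = ≤⇒≤ᵇ≡true (+-cancelˡ-≤ k _ _ (subst₂ _≤_ (toℕ-position-lab p) (toℕ-position-lab q) ≤pos))

  private variable
    K : ℕ

  multiplicity : Fin K → List (Fin K) → ℕ
  multiplicity p []       = 0
  multiplicity p (q ∷ qs) = if does (q ≟ᶠ p) then suc (multiplicity p qs) else multiplicity p qs

  multiplicity-++ : ∀ (p : Fin K) ps qs → multiplicity p (ps ++ qs) ≡ multiplicity p ps + multiplicity p qs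
  multiplicity-++ p []       qs = refl
  multiplicity-++ p (q ∷ ps) qs with does (q ≟ᶠ p)
  ... | true  = cong suc (multiplicity-++ p ps qs)
  ... | false = multiplicity-++ p ps qs

  expand : Vec ℕ K → List (Fin K)
  expand []      = []
  expand (c ∷ v) = replicate c zero ++ map suc (expand v)

  zeros : Vec ℕ K
  zeros = replicateᵛ _ 0

  increment : Fin K → Vec ℕ K → Vec ℕ K
  increment p v = updateAt v p suc

  expand-zeros : expand (zeros {K}) ≡ []
  expand-zeros {zero}  = refl
  expand-zeros {suc K} = cong (map suc) (expand-zeros {K})

  length-expand : (v : Vec ℕ K) → length (expand v) ≡ sum v
  length-expand []      = refl
  length-expand (c ∷ v) = begin
    length (replicate c zero ++ map suc (expand v))     ≡⟨ length-++ (replicate c zero) ⟩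
    length (replicate c zero) + length (map suc (expand v)) ≡⟨ cong₂ _+_ (length-replicate c) (length-map suc (expand v)) ⟩
    c + length (expand v)                               ≡⟨ cong (c +_) (length-expand v) ⟩
    c + sum v                                           ∎
    where open ≡-Reasoning

  foldr-increment-expand : (v : Vec ℕ K) → foldr increment zeros (expand v) ≡ v
  foldr-increment-expand []      = refl
  foldr-increment-expand (c ∷ v) = begin
    foldr increment zeros (replicate c zero ++ map suc (expand v))
      ≡⟨ foldr-++ increment zeros (replicate c zero) (map suc (expand v)) ⟩
    foldr increment (foldr increment zeros (map suc (expand v))) (replicate c zero)
      ≡⟨ cong (λ u → foldr increment u (replicate c zero)) (foldr-increment-map-suc 0 zeros (expand v)) ⟩
    foldr increment (0 ∷ foldr increment zeros (expand v)) (replicate c zero)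
      ≡⟨ foldr-increment-replicate c (foldr increment zeros (expand v)) ⟩
    c + 0 ∷ foldr increment zeros (expand v)
      ≡⟨ cong₂ _∷_ (+-identityʳ c) (foldr-increment-expand v) ⟩
    c ∷ v ∎
    where
    open ≡-Reasoning
    foldr-increment-map-suc : ∀ {K} c (u : Vec ℕ K) ps → foldr increment (c ∷ u) (map suc ps) ≡ c ∷ foldr increment u ps
    foldr-increment-map-suc c u []       = refl
    foldr-increment-map-suc c u (p ∷ ps) = cong (increment (suc p)) (foldr-increment-map-suc c u ps)
    foldr-increment-replicate : ∀ {K} m (u : Vec ℕ K) → foldr increment (0 ∷ u) (replicate m zero) ≡ m + 0 ∷ u
    foldr-increment-replicate zero    u = refl
    foldr-increment-replicate (suc m) u = cong (increment zero) (foldr-increment-replicate m u)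

  expand-increment : ∀ (p : Fin K) v → All (p ≤ᶠ_) (expand v) → expand (increment p v) ≡ p ∷ expand v
  expand-increment zero    (c ∷ v)     _ = refl
  expand-increment (suc p) (zero ∷ v)  p≤ = cong (map suc) (expand-increment p v (All.map ≤-pred (AllP.map⁻ p≤)))
  expand-increment (suc p) (suc c ∷ v) (() ∷ _)

  multiplicity-expand : ∀ (p : Fin K) v → multiplicity p (expand v) ≡ lookup v p
  multiplicity-expand p (c ∷ v) = trans (multiplicity-++ p (replicate c zero) _) (split p)
    where
    multiplicity-zero-replicate : ∀ {K} m → multiplicity {suc K} zero (replicate m zero) ≡ m
    multiplicity-zero-replicate zero    = refl
    multiplicity-zero-replicate (suc m) = cong suc (multiplicity-zero-replicate m)
    multiplicity-suc-replicate : ∀ {K} m (q : Fin K) → multiplicity (suc q) (replicate m zero) ≡ 0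
    multiplicity-suc-replicate zero    q = refl
    multiplicity-suc-replicate (suc m) q = multiplicity-suc-replicate m q
    multiplicity-zero-map : ∀ {K} (ps : List (Fin K)) → multiplicity zero (map suc ps) ≡ 0
    multiplicity-zero-map []       = refl
    multiplicity-zero-map (_ ∷ ps) = multiplicity-zero-map ps
    multiplicity-suc-map : ∀ {K} (q : Fin K) ps → multiplicity (suc q) (map suc ps) ≡ multiplicity q ps
    multiplicity-suc-map q []       = refl
    multiplicity-suc-map q (p ∷ ps) with does (p ≟ᶠ q)
    ... | true  = cong suc (multiplicity-suc-map q ps)
    ... | false = multiplicity-suc-map q ps
    split : ∀ q → multiplicity q (replicate c zero) + multiplicity q (map suc (expand v)) ≡ lookup (c ∷ v) q
    split zero    = trans (cong₂ _+_ (multiplicity-zero-replicate c) (multiplicity-zero-map (expand v))) (+-identityʳ c)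
    split (suc q) = trans (cong₂ _+_ (multiplicity-suc-replicate c q) (multiplicity-suc-map q (expand v))) (multiplicity-expand q v)

  expand-sorted : (v : Vec ℕ K) → Linked _≤ᶠ_ (expand v)
  expand-sorted []      = []
  expand-sorted (c ∷ v) = zeros-then c
    where
    zero-∷ : ∀ {ps} → Linked _≤ᶠ_ ps → Linked _≤ᶠ_ (zero ∷ ps)
    zero-∷ []       = [-]
    zero-∷ [-]      = z≤n ∷ [-]
    zero-∷ (p ∷ ps) = z≤n ∷ p ∷ ps
    zeros-then : ∀ m → Linked _≤ᶠ_ (replicate m zero ++ map suc (expand v))
    zeros-then zero    = LinkedP.map⁺ (Linked.map s≤s (expand-sorted v))
    zeros-then (suc m) = zero-∷ (zeros-then m)

module RunCoding where

  open import Data.Bool using (true; false; _∧_; if_then_else_)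
  open import Data.Bool.Properties using (∧-conicalˡ; ∧-conicalʳ)
  open import Data.Fin using (zero; suc; toℕ; _↑ʳ_) renaming (_≤_ to _≤ᶠ_)
  open import Data.Fin.Properties using (↑ʳ-injective; ≤-trans) renaming (_≟_ to _≟ᶠ_)
  open import Data.List using (List; []; _∷_; _++_; map; foldr; length)
  open import Data.List.Relation.Unary.All as All using (All; []; _∷_)
  open import Data.List.Relation.Unary.Linked using (Linked; []; [-]; _∷_)
  open import Data.Nat using (ℕ; zero; suc; _+_; _≤_)
  open import Data.Nat.ListAction using () renaming (sum to sumˡ)
  open import Data.Nat.Properties using (+-identityʳ; +-suc; <-irrefl; <-≤-trans)
  open import Data.Product using (_×_; _,_; proj₁; proj₂; map₁; uncurry)
  open import Data.Unit using (⊤; tt)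
  open import Data.Vec using (Vec; sum; lookup; take; drop)
  open import Data.Vec.Properties using (take++drop≡id; lookup-++ʳ; lookup-zipWith; lookup-replicate)
  open import Function using (_∘_)
  open import Relation.Binary.PropositionalEquality using (_≡_; _≢_; refl; sym; trans; cong; cong₂; subst; subst₂; module ≡-Reasoning)
  open import Relation.Nullary using (does)
  open import Relation.Nullary.Decidable using (dec-false)

  open import Defs
  open CycleLemma using (runsAbove; eastAbove)
  open Labels
  open Matrices using (columnSums)

  module Paths (k i : ℕ) where
    open Positions k i

    Row : Set
    Row = Vec ℕ (k + i)

    Path : Set
    Path = List (Step k i)

    -- A row records how often each label occurs in a maximal run of north steps.
    run : Row → Path
    run row = map (N ∘ label) (expand row)

    mutual
      decode : Row → List Row → Path
      decode row rows = run row ++ eastThen rows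

      eastThen : List Row → Path
      eastThen []           = []
      eastThen (row ∷ rows) = E ∷ decode row rows

    encode : Path → Row × List Row
    encode []        = zeros , []
    encode (E ∷ w)   = zeros , uncurry _∷_ (encode w)
    encode (N a ∷ w) = map₁ (increment (position a)) (encode w)

    encode-labels-++ : ∀ ps w → encode (map (N ∘ label) ps ++ w) ≡ map₁ (λ row → foldr increment row ps) (encode w)
    encode-labels-++ []       w = refl
    encode-labels-++ (p ∷ ps) w = cong₂ (λ q e → map₁ (increment q) e) (position-label p) (encode-labels-++ ps w)

    mutual
      encode-decode : ∀ row rows → encode (decode row rows) ≡ (row , rows)
      encode-decode row rows = begin
        encode (run row ++ eastThen rows)                     ≡⟨ encode-labels-++ (expand row) (eastThen rows) ⟩
        map₁ (λ u → foldr increment u (expand row)) (encode (eastThen rows)) ≡⟨ cong (map₁ (λ u → foldr increment u (expand row))) (encode-eastThen rows) ⟩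
        foldr increment zeros (expand row) , rows             ≡⟨ cong (_, rows) (foldr-increment-expand row) ⟩
        row , rows                                            ∎
        where open ≡-Reasoning

      encode-eastThen : ∀ rows → encode (eastThen rows) ≡ (zeros , rows)
      encode-eastThen []           = refl
      encode-eastThen (row ∷ rows) = cong (λ e → zeros , uncurry _∷_ e) (encode-decode row rows)

    Precedes : Label k i → Path → Set
    Precedes a (N b ∷ _) = (a ≤L b) ≡ true
    Precedes a _         = ⊤

    runsIncreasing-N : ∀ a w → runsIncreasing (N a ∷ w) ≡ true → Precedes a w × runsIncreasing w ≡ true
    runsIncreasing-N a []      _  = tt , refl
    runsIncreasing-N a (E ∷ w) ri = tt , ri
    runsIncreasing-N a (N b ∷ w) ri = ∧-conicalˡ (a ≤L b) _ ri , ∧-conicalʳ (a ≤L b) _ ri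

    first-run-above : ∀ a w → runsIncreasing w ≡ true → Precedes a w → All (position a ≤ᶠ_) (expand (proj₁ (encode w)))
    first-run-above a []        _  _   = subst (All _) (sym expand-zeros) []
    first-run-above a (E ∷ w)   _  _   = subst (All _) (sym expand-zeros) []
    first-run-above a (N b ∷ w) ri a≤b = subst (All _) (sym (expand-increment (position b) (proj₁ (encode w)) b≤run))
                                           (pos-a≤b ∷ All.map (≤-trans pos-a≤b) b≤run)
      where
      pos-a≤b : position a ≤ᶠ position b
      pos-a≤b = ≤L⇒≤-position a b a≤b
      b≤run : All (position b ≤ᶠ_) (expand (proj₁ (encode w)))
      b≤run = first-run-above b w (proj₂ (runsIncreasing-N b w ri)) (proj₁ (runsIncreasing-N b w ri))

    decode-encode : ∀ w → runsIncreasing w ≡ true → uncurry decode (encode w) ≡ w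
    decode-encode []        _  = cong (λ ps → map (N ∘ label) ps ++ []) expand-zeros
    decode-encode (E ∷ w)   ri = trans (cong (λ ps → map (N ∘ label) ps ++ E ∷ uncurry decode (encode w)) expand-zeros)
                                       (cong (E ∷_) (decode-encode w ri))
    decode-encode (N a ∷ w) ri = begin
      run (increment (position a) row) ++ eastThen rows   ≡⟨ cong (λ ps → map (N ∘ label) ps ++ eastThen rows)
                                                               (expand-increment (position a) row (first-run-above a w ri′ a≤w)) ⟩
      N (label (position a)) ∷ run row ++ eastThen rows   ≡⟨ cong₂ (λ b w′ → N b ∷ w′) (label-position a) (decode-encode w ri′) ⟩
      N a ∷ w                                            ∎
      where
      open ≡-Reasoning
      row : Row
      row = proj₁ (encode w)
      rows : List Row
      rows = proj₂ (encode w)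
      a≤w : Precedes a w
      a≤w = proj₁ (runsIncreasing-N a w ri)
      ri′ : runsIncreasing w ≡ true
      ri′ = proj₂ (runsIncreasing-N a w ri)

    numN-labels-++ : ∀ ps w → numN (map (N ∘ label) ps ++ w) ≡ length ps + numN w
    numN-labels-++ []       w = refl
    numN-labels-++ (p ∷ ps) w = cong suc (numN-labels-++ ps w)

    numE-labels-++ : ∀ ps w → numE (map (N ∘ label) ps ++ w) ≡ numE w
    numE-labels-++ []       w = refl
    numE-labels-++ (p ∷ ps) w = numE-labels-++ ps w

    staysAbove-labels-++ : ∀ h ps w → staysAbove h (map (N ∘ label) ps ++ w) ≡ staysAbove (h + length ps) w
    staysAbove-labels-++ h []       w = cong (λ h′ → staysAbove h′ w) (sym (+-identityʳ h))
    staysAbove-labels-++ h (p ∷ ps) w = trans (staysAbove-labels-++ (suc h) ps w) (cong (λ h′ → staysAbove h′ w) (sym (+-suc h (length ps))))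

    occ-N : ∀ j a w → occ j (N a ∷ w) ≡ (if does (position a ≟ᶠ k ↑ʳ j) then suc (occ j w) else occ j w)
    occ-N j (bar q) w = cong (λ b → if b then suc (occ j w) else occ j w) (sym (dec-false (position (bar q) ≟ᶠ k ↑ʳ j) bar≢lab))
      where
      bar≢lab : position (bar q) ≢ k ↑ʳ j
      bar≢lab eq = <-irrefl refl (<-≤-trans (position-bar<k q) (subst (k ≤_) (cong toℕ (sym eq)) (k≤position-lab j)))
    occ-N j (lab q) w = cong (λ b → if b then suc (occ j w) else occ j w) (does-⇔ (q ≟ᶠ j) (k ↑ʳ q ≟ᶠ k ↑ʳ j) (cong (k ↑ʳ_)) (↑ʳ-injective k q j))

    occ-labels-++ : ∀ j ps w → occ j (map (N ∘ label) ps ++ w) ≡ multiplicity (k ↑ʳ j) ps + occ j w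
    occ-labels-++ j []       w = refl
    occ-labels-++ j (p ∷ ps) w = begin
      occ j (N (label p) ∷ map (N ∘ label) ps ++ w)
        ≡⟨ occ-N j (label p) _ ⟩
      (if does (position (label p) ≟ᶠ k ↑ʳ j) then suc (occ j (map (N ∘ label) ps ++ w)) else occ j (map (N ∘ label) ps ++ w))
        ≡⟨ cong₂ (λ q o → if does (q ≟ᶠ k ↑ʳ j) then suc o else o) (position-label p) (occ-labels-++ j ps w) ⟩
      (if does (p ≟ᶠ k ↑ʳ j) then suc (multiplicity (k ↑ʳ j) ps + occ j w) else multiplicity (k ↑ʳ j) ps + occ j w)
        ≡⟨ if-+ (does (p ≟ᶠ k ↑ʳ j)) ⟩
      multiplicity (k ↑ʳ j) (p ∷ ps) + occ j w ∎
      where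
      open ≡-Reasoning
      if-+ : ∀ b → (if b then suc (multiplicity (k ↑ʳ j) ps + occ j w) else multiplicity (k ↑ʳ j) ps + occ j w)
                   ≡ (if b then suc (multiplicity (k ↑ʳ j) ps) else multiplicity (k ↑ʳ j) ps) + occ j w
      if-+ true  = refl
      if-+ false = refl

    runsIncreasing-labels-++ : ∀ {ps} rows → Linked _≤ᶠ_ ps →
                               runsIncreasing (map (N ∘ label) ps ++ eastThen rows) ≡ runsIncreasing (eastThen rows)
    runsIncreasing-labels-++ rows       []          = refl
    runsIncreasing-labels-++ []         [-]         = refl
    runsIncreasing-labels-++ (_ ∷ _)    [-]         = refl
    runsIncreasing-labels-++ {p ∷ q ∷ _} rows (p≤q ∷ sorted) =
      cong₂ _∧_ (≤-position⇒≤L (label p) (label q) (subst₂ _≤ᶠ_ (sym (position-label p)) (sym (position-label q)) p≤q))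
                (runsIncreasing-labels-++ rows sorted)

    mutual
      runsIncreasing-decode : ∀ row rows → runsIncreasing (decode row rows) ≡ true
      runsIncreasing-decode row rows = trans (runsIncreasing-labels-++ rows (expand-sorted row)) (runsIncreasing-eastThen rows)

      runsIncreasing-eastThen : ∀ rows → runsIncreasing (eastThen rows) ≡ true
      runsIncreasing-eastThen []           = refl
      runsIncreasing-eastThen (row ∷ rows) = runsIncreasing-decode row rows

    mutual
      numN-decode : ∀ row rows → numN (decode row rows) ≡ sumˡ (map sum (row ∷ rows))
      numN-decode row rows = trans (numN-labels-++ (expand row) (eastThen rows)) (cong₂ _+_ (length-expand row) (numN-eastThen rows))

      numN-eastThen : ∀ rows → numN (eastThen rows) ≡ sumˡ (map sum rows)
      numN-eastThen []           = refl
      numN-eastThen (row ∷ rows) = numN-decode row rows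

    numE-decode : ∀ row rows → numE (decode row rows) ≡ length rows
    numE-decode row []            = numE-labels-++ (expand row) []
    numE-decode row (row′ ∷ rows) = trans (numE-labels-++ (expand row) _) (cong suc (numE-decode row′ rows))

    mutual
      staysAbove-decode : ∀ h row rows → staysAbove h (decode row rows) ≡ runsAbove h (map sum (row ∷ rows))
      staysAbove-decode h row []            = staysAbove-labels-++ h (expand row) []
      staysAbove-decode h row (row′ ∷ rows) = begin
        staysAbove h (run row ++ E ∷ decode row′ rows)         ≡⟨ staysAbove-labels-++ h (expand row) _ ⟩
        staysAbove (h + length (expand row)) (E ∷ decode row′ rows) ≡⟨ cong (λ l → staysAbove (h + l) (E ∷ decode row′ rows)) (length-expand row) ⟩
        staysAbove (h + sum row) (E ∷ decode row′ rows)        ≡⟨ staysAbove-E (h + sum row) row′ rows ⟩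
        eastAbove (h + sum row) (map sum (row′ ∷ rows))        ∎
        where open ≡-Reasoning

      staysAbove-E : ∀ h row rows → staysAbove h (E ∷ decode row rows) ≡ eastAbove h (map sum (row ∷ rows))
      staysAbove-E zero    row rows = refl
      staysAbove-E (suc h) row rows = staysAbove-decode h row rows

    bars : Row → Vec ℕ k
    bars = take k

    labels : Row → Vec ℕ i
    labels = drop k

    lookup-labels : ∀ row j → lookup row (k ↑ʳ j) ≡ lookup (labels row) j
    lookup-labels row j = trans (cong (λ v → lookup v (k ↑ʳ j)) (sym (take++drop≡id k row))) (lookup-++ʳ (bars row) (labels row) j)

    mutual
      occ-decode : ∀ j row rows → occ j (decode row rows) ≡ lookup (columnSums (map labels (row ∷ rows))) j
      occ-decode j row rows = begin
        occ j (run row ++ eastThen rows)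
          ≡⟨ occ-labels-++ j (expand row) (eastThen rows) ⟩
        multiplicity (k ↑ʳ j) (expand row) + occ j (eastThen rows)
          ≡⟨ cong₂ _+_ (trans (multiplicity-expand (k ↑ʳ j) row) (lookup-labels row j)) (occ-eastThen j rows) ⟩
        lookup (labels row) j + lookup (columnSums (map labels rows)) j
          ≡⟨ sym (lookup-zipWith _+_ j (labels row) (columnSums (map labels rows))) ⟩
        lookup (columnSums (map labels (row ∷ rows))) j ∎
        where open ≡-Reasoning

      occ-eastThen : ∀ j rows → occ j (eastThen rows) ≡ lookup (columnSums (map labels rows)) j
      occ-eastThen j []           = sym (lookup-replicate j 0)
      occ-eastThen j (row ∷ rows) = occ-decode j row rows

module Counting where

  open import Data.Bool using (Bool; true; _∧_)
  open import Data.Bool.Properties using (T-≡; ∧-conicalˡ; ∧-conicalʳ)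
  open import Data.Fin using (Fin)
  open import Data.Fin.Properties using (*↔×)
  open import Data.List using (List; []; _∷_; map; length; allFin)
  import Data.List.Relation.Binary.Permutation.Propositional.Properties as ↭
  open import Data.List.Relation.Unary.All using (All; []; _∷_)
  open import Data.List.Relation.Unary.All.Properties using (tabulate⁺; tabulate⁻)
  open import Data.Nat using (ℕ; zero; suc; _+_; _*_; _^_; _∸_; _≤_; _≡ᵇ_)
  open import Data.Nat.ListAction using () renaming (sum to sumˡ)
  open import Data.Nat.ListAction.Properties using (sum-↭)
  open import Data.Nat.Properties using (≡ᵇ⇒≡; ≡⇒≡ᵇ; m∸n+n≡m; m+n∸n≡m; *-comm)
  import Data.Nat.Properties as ℕ
  open import Data.Nat.Tactic.RingSolver using (solve-∀)
  open import Data.Product using (Σ; _×_; _,_; proj₁; proj₂)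
  open import Data.Product.Function.NonDependent.Propositional using (_×-↔_)
  open import Data.Vec using (Vec; sum; lookup; replicate; toList) renaming (map to mapᵛ; [] to []ᵛ; _∷_ to _∷ᵛ_)
  open import Data.Vec.Properties using (lookup-replicate; toList-map; take++drop≡id; sum-++)
  open import Function using (_∘_)
  open import Function.Bundles using (_↔_; _⇔_; mk⇔; mk↔ₛ′; Equivalence; Inverse)
  open import Function.Properties.Inverse using (↔-refl; ↔-sym)
  open import Function.Related.TypeIsomorphisms using (×-comm)
  open import Relation.Binary.PropositionalEquality using (_≡_; refl; sym; trans; cong; cong₂; subst; module ≡-Reasoning)
  open import Relation.Nullary using (Irrelevant)

  open import Defs
  open Cardinalities
  open CycleLemma
  open Labels
  open RunCoding
  open Matrices

  ≡ᵇ-≡true⇔≡ : ∀ m n → (m ≡ᵇ n) ≡ true ⇔ m ≡ n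
  ≡ᵇ-≡true⇔≡ m n = mk⇔ (≡ᵇ⇒≡ m n ∘ Equivalence.from T-≡) (Equivalence.to T-≡ ∘ ≡⇒≡ᵇ m n)

  allB-≡true⇔All : ∀ {A : Set} (p : A → Bool) xs → allB p xs ≡ true ⇔ All (λ x → p x ≡ true) xs
  allB-≡true⇔All p xs = mk⇔ (to xs) (from xs)
    where
    to : ∀ xs → allB p xs ≡ true → All (λ x → p x ≡ true) xs
    to []       _  = []
    to (x ∷ xs) eq = ∧-conicalˡ (p x) _ eq ∷ to xs (∧-conicalʳ (p x) _ eq)
    from : ∀ xs → All (λ x → p x ≡ true) xs → allB p xs ≡ true
    from []       []         = refl
    from (x ∷ xs) (px ∷ pxs) = cong₂ _∧_ px (from xs pxs)

  allB-allFin⇔ : ∀ {n} (p : Fin n → Bool) → allB p (allFin n) ≡ true ⇔ (∀ j → p j ≡ true)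
  allB-allFin⇔ p = mk⇔ (tabulate⁻ ∘ Equivalence.to (allB-≡true⇔All p _)) (Equivalence.from (allB-≡true⇔All p _) ∘ tabulate⁺)

  lookup≡1⇔≡replicate : ∀ {n} (v : Vec ℕ n) → (∀ j → lookup v j ≡ 1) ⇔ v ≡ replicate n 1
  lookup≡1⇔≡replicate v = mk⇔ (λ v≡1 → lookup-extensionality λ j → trans (v≡1 j) (sym (lookup-replicate j 1)))
                              (λ { refl j → lookup-replicate j 1 })

  sum-replicate-1 : ∀ n → sum (replicate n 1) ≡ n
  sum-replicate-1 zero    = refl
  sum-replicate-1 (suc n) = cong suc (sum-replicate-1 n)

  module Main (k r i : ℕ) (i≤r : i ≤ r) where
    open Positions k i
    open Paths k i

    barTotal : List Row → ℕ
    barTotal rows = sumˡ (map (sum ∘ bars) rows)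

    labelCounts : List Row → Vec ℕ i
    labelCounts rows = columnSums (map labels rows)

    -- The run lists of paths of 𝒯_k(r,i), with the Dyck condition dropped.
    Admissible : List Row → Set
    Admissible rows = length rows ≡ suc r × barTotal rows ≡ r ∸ i × labelCounts rows ≡ replicate i 1

    Admissible-irrelevant : ∀ {rows} → Irrelevant (Admissible rows)
    Admissible-irrelevant = ×-irrelevant ℕ.≡-irrelevant (×-irrelevant ℕ.≡-irrelevant Vec-≡-irrelevant)

    sum-rows : ∀ rows → sumˡ (map sum rows) ≡ barTotal rows + sum (labelCounts rows)
    sum-rows []           = sym (sum-columnSums {i} [])
    sum-rows (row ∷ rows) = begin
      sum row + sumˡ (map sum rows)
        ≡⟨ cong₂ _+_ (trans (cong sum (sym (take++drop≡id k row))) (sum-++ (bars row))) (sum-rows rows) ⟩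
      (sum (bars row) + sum (labels row)) + (barTotal rows + sum (labelCounts rows))
        ≡⟨ interchange (sum (bars row)) (sum (labels row)) (barTotal rows) (sum (labelCounts rows)) ⟩
      (sum (bars row) + barTotal rows) + (sum (labels row) + sum (labelCounts rows))
        ≡⟨ cong (sum (bars row) + barTotal rows +_) (sym (sum-zipWith-+ (labels row) (labelCounts rows))) ⟩
      barTotal (row ∷ rows) + sum (labelCounts (row ∷ rows)) ∎
      where
      open ≡-Reasoning
      interchange : ∀ a b c d → (a + b) + (c + d) ≡ (a + c) + (b + d)
      interchange = solve-∀

    Admissible-sum : ∀ rows → Admissible rows → sumˡ (map sum rows) ≡ r
    Admissible-sum rows (_ , bars≡ , labels≡) = begin
      sumˡ (map sum rows)                   ≡⟨ sum-rows rows ⟩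
      barTotal rows + sum (labelCounts rows) ≡⟨ cong₂ _+_ bars≡ (cong sum labels≡) ⟩
      r ∸ i + sum (replicate i 1)           ≡⟨ cong (r ∸ i +_) (sum-replicate-1 i) ⟩
      r ∸ i + i                             ≡⟨ m∸n+n≡m i≤r ⟩
      r                                     ∎
      where
      open ≡-Reasoning

    Admissible-rotate : ∀ j rows → Admissible rows → Admissible (rotate j rows)
    Admissible-rotate j rows (length≡ , bars≡ , labels≡) =
      trans (length-rotate j rows) length≡ ,
      trans (sum-↭ (↭.map⁺ (sum ∘ bars) (rotate-↭ j rows))) bars≡ ,
      trans (columnSums-↭ (↭.map⁺ labels (rotate-↭ j rows))) labels≡

    open Cycle sum r Admissible (λ {rows} → Admissible-irrelevant {rows}) Admissible-rotate (λ rows → proj₁) Admissible-sum public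

    record Valid (w : Path) : Set where
      field
        numN≡r     : numN w ≡ r
        numE≡r     : numE w ≡ r
        above      : staysAbove 0 w ≡ true
        labelled   : labelsOnce w ≡ true
        increasing : runsIncreasing w ≡ true

    isTk⇒Valid : ∀ w → isTk k r i w ≡ true → Valid w
    isTk⇒Valid w valid = record
      { numN≡r = Equivalence.to (≡ᵇ-≡true⇔≡ _ r) (∧-conicalˡ _ _ valid)
      ; numE≡r = Equivalence.to (≡ᵇ-≡true⇔≡ _ r) (∧-conicalˡ _ _ valid₁)
      ; above = ∧-conicalˡ _ _ valid₂
      ; labelled = ∧-conicalˡ _ _ valid₃
      ; increasing = ∧-conicalʳ (labelsOnce w) _ valid₃ }
      where
      valid₁ : (numE w ≡ᵇ r) ∧ staysAbove 0 w ∧ labelsOnce w ∧ runsIncreasing w ≡ true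
      valid₁ = ∧-conicalʳ (numN w ≡ᵇ r) _ valid
      valid₂ : staysAbove 0 w ∧ labelsOnce w ∧ runsIncreasing w ≡ true
      valid₂ = ∧-conicalʳ (numE w ≡ᵇ r) _ valid₁
      valid₃ : labelsOnce w ∧ runsIncreasing w ≡ true
      valid₃ = ∧-conicalʳ (staysAbove 0 w) _ valid₂

    Valid⇒isTk : ∀ w → Valid w → isTk k r i w ≡ true
    Valid⇒isTk w valid = cong₂ _∧_ (Equivalence.from (≡ᵇ-≡true⇔≡ _ r) numN≡r)
                        (cong₂ _∧_ (Equivalence.from (≡ᵇ-≡true⇔≡ _ r) numE≡r)
                        (cong₂ _∧_ above (cong₂ _∧_ labelled increasing)))
      where open Valid valid

    labelsOnce-decode : ∀ row rows → labelsOnce (decode row rows) ≡ true ⇔ labelCounts (row ∷ rows) ≡ replicate i 1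
    labelsOnce-decode row rows = mk⇔
      (λ once → to (lookup≡1⇔≡replicate _) λ j →
         trans (sym (occ-decode j row rows)) (to (≡ᵇ-≡true⇔≡ _ 1) (to (allB-allFin⇔ _) once j)))
      (λ counts → from (allB-allFin⇔ _) λ j →
         from (≡ᵇ-≡true⇔≡ _ 1) (trans (occ-decode j row rows) (from (lookup≡1⇔≡replicate _) counts j)))
      where open Equivalence

    decode-Valid : ∀ row rows → Good (row ∷ rows) → Valid (decode row rows)
    decode-Valid row rows ((length≡ , bars≡ , labels≡) , above) = record
      { numN≡r = trans (numN-decode row rows) (Admissible-sum (row ∷ rows) (length≡ , bars≡ , labels≡))
      ; numE≡r = trans (numE-decode row rows) (ℕ.suc-injective length≡)
      ; above = trans (staysAbove-decode 0 row rows) above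
      ; labelled = Equivalence.from (labelsOnce-decode row rows) labels≡
      ; increasing = runsIncreasing-decode row rows }

    encode-Good : ∀ w → Valid w → Good (proj₁ (encode w) ∷ proj₂ (encode w))
    encode-Good w valid = (length≡ , bars≡ , labels≡) , trans (sym (staysAbove-decode 0 row rows)) (trans (cong (staysAbove 0) decoded) above)
      where
      open Valid valid
      row : Row
      row = proj₁ (encode w)
      rows : List Row
      rows = proj₂ (encode w)
      decoded : decode row rows ≡ w
      decoded = decode-encode w increasing
      length≡ : suc (length rows) ≡ suc r
      length≡ = cong suc (trans (sym (numE-decode row rows)) (trans (cong numE decoded) numE≡r))
      labels≡ : labelCounts (row ∷ rows) ≡ replicate i 1
      labels≡ = Equivalence.to (labelsOnce-decode row rows) (subst (λ w′ → labelsOnce w′ ≡ true) (sym decoded) labelled)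
      bars≡ : barTotal (row ∷ rows) ≡ r ∸ i
      bars≡ = begin
        barTotal (row ∷ rows)                           ≡⟨ sym (m+n∸n≡m _ i) ⟩
        barTotal (row ∷ rows) + i ∸ i                   ≡⟨ cong (λ l → barTotal (row ∷ rows) + l ∸ i) (sym (trans (cong sum labels≡) (sum-replicate-1 i))) ⟩
        barTotal (row ∷ rows) + sum (labelCounts (row ∷ rows)) ∸ i ≡⟨ cong (_∸ i) (sym (sum-rows (row ∷ rows))) ⟩
        sumˡ (map sum (row ∷ rows)) ∸ i                 ≡⟨ cong (_∸ i) (trans (sym (numN-decode row rows)) (trans (cong numN decoded) numN≡r)) ⟩
        r ∸ i                                           ∎
        where open ≡-Reasoning

    𝒯↔Good : 𝒯 k r i ↔ Σ (List Row) Good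
    𝒯↔Good = mk↔ₛ′ to from to∘from from∘to
      where
      to : 𝒯 k r i → Σ (List Row) Good
      to (w , valid) = proj₁ (encode w) ∷ proj₂ (encode w) , encode-Good w (isTk⇒Valid w valid)
      from : Σ (List Row) Good → 𝒯 k r i
      from ([] , (() , _) , _)
      from (row ∷ rows , good) = decode row rows , Valid⇒isTk _ (decode-Valid row rows good)
      to∘from : ∀ y → to (from y) ≡ y
      to∘from ([] , (() , _) , _)
      to∘from (row ∷ rows , good) = Σ-≡-irrelevant (λ {xs} → Good-irrelevant {xs}) (cong (λ (row′ , rows′) → row′ ∷ rows′) (encode-decode row rows))
      from∘to : ∀ x → from (to x) ≡ x
      from∘to (w , valid) = Σ-≡-irrelevant ≡true-irrelevant (decode-encode w (Valid.increasing (isTk⇒Valid w valid)))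

    barTotal-toList : ∀ {n} (V : Vec Row n) → barTotal (toList V) ≡ sum (mapᵛ sum (mapᵛ bars V))
    barTotal-toList []ᵛ      = refl
    barTotal-toList (v ∷ᵛ V) = cong (sum (bars v) +_) (barTotal-toList V)

    Admissible↔Fin : Σ (List Row) Admissible ↔ Fin (suc r ^ i * multichoose (k * suc r) (r ∸ i))
    Admissible↔Fin = begin
      Σ (List Row) Admissible
        ↔⟨ Σ-List-length↔Σ-Vec (suc r) (×-irrelevant ℕ.≡-irrelevant Vec-≡-irrelevant) ⟩
      Σ (Vec Row (suc r)) (λ V → barTotal (toList V) ≡ r ∸ i × labelCounts (toList V) ≡ replicate i 1)
        ↔⟨ Σ-↔-irrelevant split (λ {_} → bars-labels-irrelevant) (λ {_} → bars-labels-irrelevant)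
             transport (λ BL → transport⁻ (Inverse.from split BL) ∘ subst RowCondition (sym (Inverse.strictlyInverseˡ split BL))) ⟩
      Σ (Vec (Vec ℕ k) (suc r) × Vec (Vec ℕ i) (suc r)) RowCondition
        ↔⟨ Σ-×-↔ ⟩
      (Σ (Vec (Vec ℕ k) (suc r)) (λ B → sum (mapᵛ sum B) ≡ r ∸ i) × Σ (Vec (Vec ℕ i) (suc r)) (λ L → columnSums (toList L) ≡ replicate i 1))
        ↔⟨ matrix-total↔Fin (suc r) k (r ∸ i) ×-↔ unit-columns↔Fin i (suc r) ⟩
      (Fin (multichoose (suc r * k) (r ∸ i)) × Fin (suc r ^ i))
        ↔⟨ ×-comm _ _ ⟩
      (Fin (suc r ^ i) × Fin (multichoose (suc r * k) (r ∸ i)))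
        ↔⟨ ↔-sym *↔× ⟩
      Fin (suc r ^ i * multichoose (suc r * k) (r ∸ i))
        ≡⟨ cong (λ n → Fin (suc r ^ i * multichoose n (r ∸ i))) (*-comm (suc r) k) ⟩
      Fin (suc r ^ i * multichoose (k * suc r) (r ∸ i)) ∎
      where
      open ↔-Reasoning
      split : Vec Row (suc r) ↔ (Vec (Vec ℕ k) (suc r) × Vec (Vec ℕ i) (suc r))
      split = split-columns-↔ k i
      RowCondition : Vec (Vec ℕ k) (suc r) × Vec (Vec ℕ i) (suc r) → Set
      RowCondition (B , L) = sum (mapᵛ sum B) ≡ r ∸ i × columnSums (toList L) ≡ replicate i 1
      bars-labels-irrelevant : ∀ {m} {a b : ℕ} {u v : Vec ℕ m} → Irrelevant (a ≡ b × u ≡ v)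
      bars-labels-irrelevant = ×-irrelevant ℕ.≡-irrelevant Vec-≡-irrelevant
      transport : ∀ V → barTotal (toList V) ≡ r ∸ i × labelCounts (toList V) ≡ replicate i 1 →
                  sum (mapᵛ sum (mapᵛ bars V)) ≡ r ∸ i × columnSums (toList (mapᵛ labels V)) ≡ replicate i 1
      transport V (bars≡ , labels≡) = trans (sym (barTotal-toList V)) bars≡ , trans (cong columnSums (toList-map labels V)) labels≡
      transport⁻ : ∀ V → sum (mapᵛ sum (mapᵛ bars V)) ≡ r ∸ i × columnSums (toList (mapᵛ labels V)) ≡ replicate i 1 →
                   barTotal (toList V) ≡ r ∸ i × labelCounts (toList V) ≡ replicate i 1
      transport⁻ V (bars≡ , labels≡) = trans (barTotal-toList V) bars≡ , trans (cong columnSums (sym (toList-map labels V))) labels≡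

open Cardinalities using (↔-cancel-×Fin; module ↔-Reasoning)
open RunCoding using (module Paths)
open Counting using (module Main)

theorem3p18 : (k r i : ℕ) → i ≤ r → 𝒯 k r i ↔ Fin (Tformula k r i)
theorem3p18 k r i i≤r = ↔-cancel-×Fin (begin
  (𝒯 k r i × Fin (suc r))                           ↔⟨ 𝒯↔Good ×-↔ ↔-refl ⟩
  (Σ (List Row) Good × Fin (suc r))                 ↔⟨ cycle-↔ ⟩
  Σ (List Row) Admissible                           ↔⟨ Admissible↔Fin ⟩
  Fin (suc r ^ i * multichoose (k * suc r) (r ∸ i)) ∎)
  where
  open Paths k i using (Row)
  open Main k r i i≤r
  open ↔-Reasoning
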